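{- For all integers $m,k,j,\ell\geq 0$ with $j\ge k$, $$\sum_{C\in\mathscr{C}_{m,k,j}^{\ell}}\prod_{i\geq1}t_i^{u_i(C)}\prod_{i\geq1}s_i^{h_i(C)} =\binom{j-k+1}{\ell}\frac{(j-k)!\,\ell!}{k!\,m!}\,\mathbf{B}_{m,j-k}\big(1!t_1,2!t_2,\ldots\big)\,\mathbf{B}_{k,\ell}\big(1!s_1,2!s_2,\ldots\big).$$
   Context: The $t_i,s_i$ are commuting indeterminates. A composition of a nonnegative integer $m$ into $j$ parts is an ordered sequence $(\lambda_1,\ldots,\lambda_j)$ of nonnegative integers summing to $m$. $\mathscr{C}_{m,k,j}$ is the set of compositions of $m$ into $j$ parts exactly $k$ of which are zero. For a composition $C$, $u_i(C)$ is the number of parts equal to $i$ ($i\ge1$), and $h_i(C)$ is the number of maximal runs of consecutive zero parts of length exactly $i$; these maximal runs of zeros are called $h$-segments. $\mathscr{C}_{m,k,j}^{\ell}$ is the subset of $\mathscr{C}_{m,k,j}$ of compositions with exactly $\ell$ $h$-segments. The partial Bell polynomial is $\mathbf{B}_{n,r}(x_1,x_2,\ldots)=\sum \frac{n!}{r_1!\cdots r_n!}\prod_{i=1}^n\left(\frac{x_i}{i!}\right)^{r_i}$, summed over nonnegative integer solutions of $r_1+\cdots+r_n=r$, $r_1+2r_2+\cdots+nr_n=n$ (so $\mathbf{B}_{0,0}=1$, $\mathbf{B}_{n,0}=0$ for $n\ge1$). -}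

module Defs where

open import Data.Nat using (ℕ; zero; suc; _∸_; _≡ᵇ_; _!)
open import Data.Nat.Properties using (_!≢0)
open import Data.Integer using (+_)
open import Data.Rational using (ℚ; 0ℚ; 1ℚ; _+_; _*_; _/_)
open import Data.Bool using (Bool; true; false; _∧_; if_then_else_)
open import Data.Fin using (toℕ)
open import Data.Product using (_×_; _,_)
open import Data.List using (List; []; _∷_; _++_; map; concatMap; upTo; filterᵇ; length; foldr)
open import Data.Vec as Vec using (Vec; toList)

ℕ→ℚ : ℕ → ℚ
ℕ→ℚ n = + n / 1

inv! : ℕ → ℚ
inv! n = _/_ (+ 1) (n !) {{n !≢0}}

qsum : List ℚ → ℚ
qsum = foldr _+_ 0ℚ

qprod : List ℚ → ℚ
qprod = foldr _*_ 1ℚ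

infixr 8 _^ℚ_
_^ℚ_ : ℚ → ℕ → ℚ
x ^ℚ zero  = 1ℚ
x ^ℚ suc n = x * (x ^ℚ n)

nsum : List ℕ → ℕ
nsum = foldr Data.Nat._+_ 0

oneTo : ℕ → List ℕ
oneTo n = map suc (upTo n)

allVecs : ℕ → (j : ℕ) → List (Vec ℕ j)
allVecs b zero    = Vec.[] ∷ []
allVecs b (suc j) = concatMap (λ a → map (a Vec.∷_) (allVecs b j)) (upTo (suc b))

count : ℕ → List ℕ → ℕ
count i []       = 0
count i (x ∷ xs) = if i ≡ᵇ x then suc (count i xs) else count i xs

-- lengths of the maximal runs of consecutive zeros (the h-segments),
-- scanning left to right; the first argument is the length of the
-- current (not yet closed) run of zeros
closeRun : ℕ → List ℕ
closeRun zero    = []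
closeRun (suc c) = suc c ∷ []

runs : ℕ → List ℕ → List ℕ
runs c []           = closeRun c
runs c (zero ∷ xs)  = runs (suc c) xs
runs c (suc _ ∷ xs) = closeRun c ++ runs 0 xs

zeroRuns : List ℕ → List ℕ
zeroRuns = runs 0

module _ {j : ℕ} (c : Vec ℕ j) where
  u : ℕ → ℕ
  u i = count i (toList c)

  h : ℕ → ℕ
  h i = count i (zeroRuns (toList c))

  numZeros : ℕ
  numZeros = count 0 (toList c)

  numSegments : ℕ
  numSegments = length (zeroRuns (toList c))

  partsSum : ℕ
  partsSum = nsum (toList c)

-- 𝒞^ℓ_{m,k,j}: compositions of m into j (nonnegative) parts, exactly k of them
-- zero, with exactly ℓ h-segments.  Every part of a composition of m is ≤ m,
-- so enumerating vectors with entries in {0..m} is exhaustive.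
compositions : (m k j ℓ : ℕ) → List (Vec ℕ j)
compositions m k j ℓ =
  filterᵇ (λ c → (partsSum c ≡ᵇ m) ∧ (numZeros c ≡ᵇ k) ∧ (numSegments c ≡ᵇ ℓ))
          (allVecs m j)

-- ∏_{i≥1} t_i^{u_i(C)} ∏_{i≥1} s_i^{h_i(C)} for C a composition of m into j parts
-- (u_i(C) = 0 for i > m and h_i(C) = 0 for i > j, so the products are finite)
weight : (m j : ℕ) → (t s : ℕ → ℚ) → Vec ℕ j → ℚ
weight m j t s c =
  qprod (map (λ i → t i ^ℚ u c i) (oneTo m)) * qprod (map (λ i → s i ^ℚ h c i) (oneTo j))

-- Partial Bell polynomial B_{n,r}(x_1, x_2, ...):
-- sum over (r_1,...,r_n) ∈ ℕ^n with Σ r_i = r, Σ i r_i = n of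
--   n! / (r_1! ⋯ r_n!) ∏ (x_i / i!)^{r_i}
-- (each r_i ≤ n, so enumerating entries in {0..n} is exhaustive)
indexed : {n : ℕ} → Vec ℕ n → List (ℕ × ℕ)
indexed {n} rs = toList (Vec.zip (Vec.tabulate (λ p → suc (toℕ p))) rs)

bellTerm : (n : ℕ) → (x : ℕ → ℚ) → Vec ℕ n → ℚ
bellTerm n x rs =
  ℕ→ℚ (n !) * qprod (map (λ { (i , ri) → ((x i * inv! i) ^ℚ ri) * inv! ri }) (indexed rs))

bell : (n r : ℕ) → (x : ℕ → ℚ) → ℚ
bell n r x =
  qsum (map (bellTerm n x)
    (filterᵇ (λ rs → (nsum (toList rs) ≡ᵇ r)
                     ∧ (nsum (map (λ { (i , ri) → i Data.Nat.* ri }) (indexed rs)) ≡ᵇ n))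
             (allVecs n n)))

module Submission where

-- Corollary 3.3.  Both sides are compared with the ordered composition
-- polynomial  compPoly x μ n = Σ_{a₁+⋯+aₙ = μ, aᵢ ≥ 1} x_{a₁}⋯x_{aₙ}.
-- (1) Bell side (modules Multiplicities, Enumerated):
--     r!·B_{n,r}(i!xᵢ) = n!·compPoly x n r.  The Bell sum is a sum over
--     multiplicity vectors; marking one of the ρ+1 parts gives
--     (ρ+1)·Q(ν,ρ+1) = Σᵢ xᵢ·Q(ν-i,ρ), the defining recurrence of compPoly.
-- (2) Composition side (module Scan): the weighted sum is
--     C(n+1,ℓ)·compPoly t m n·compPoly s k ℓ with n = j-k, since the positive
--     parts compose m, the zero runs compose k, and the runs occupy ℓ of the
--     n+1 gaps.  It is proved by scanning compositions from the left with the
--     length of the open zero run as state, and checking that a closed form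
--     satisfies the same first-part recurrence.

open import Defs
open import Data.Nat using (ℕ; zero; suc; _≤_; _<_; _∸_; _!; z≤n; s≤s)
import Data.Nat as ℕ
import Data.Nat.Properties as ℕP
open import Data.Nat.Combinatorics using (_C_; nCk+nC[k+1]≡[n+1]C[k+1])
import Data.Integer as ℤ
import Data.Integer.Properties as ℤP
open import Data.Rational using (ℚ; 0ℚ; 1ℚ; _+_; _*_; _/_; toℚᵘ)
import Data.Rational.Properties as ℚP
import Data.Rational.Unnormalised as ℚᵘ
import Data.Rational.Unnormalised.Properties as ℚᵘP
open import Data.Rational.Solver using (module +-*-Solver)
open +-*-Solver using (solve; _:+_; _:*_; _:=_; con)
open import Data.Bool using (Bool; true; false; _∧_; if_then_else_)
open import Data.List using (List; []; _∷_; _++_; map; concatMap; upTo; filterᵇ; length; applyUpTo)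
open import Data.Vec as Vec using (Vec)
open import Data.Fin as Fin using (Fin; toℕ)
open import Data.Product using (_×_; _,_)
open import Relation.Binary.PropositionalEquality

-- ℕ→ℚ is, through the unnormalised rationals, the fraction n/1; this makes
-- it additive and multiplicative.
toℚᵘ-ℕ→ℚ : ∀ n → toℚᵘ (ℕ→ℚ n) ℚᵘ.≃ ℚᵘ.mkℚᵘ (ℤ.+ n) 0
toℚᵘ-ℕ→ℚ n = ℚP.toℚᵘ-fromℚᵘ (ℚᵘ.mkℚᵘ (ℤ.+ n) 0)

ℕ→ℚ-+ : ∀ a b → ℕ→ℚ (a ℕ.+ b) ≡ ℕ→ℚ a + ℕ→ℚ b
ℕ→ℚ-+ a b = ℚP.toℚᵘ-injective (ℚᵘP.≃-trans (toℚᵘ-ℕ→ℚ (a ℕ.+ b))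
  (ℚᵘP.≃-trans fractions (ℚᵘP.≃-sym (ℚᵘP.≃-trans (ℚP.toℚᵘ-homo-+ (ℕ→ℚ a) (ℕ→ℚ b))
                                                  (ℚᵘP.+-cong (toℚᵘ-ℕ→ℚ a) (toℚᵘ-ℕ→ℚ b))))))
  where
  fractions : ℚᵘ.mkℚᵘ (ℤ.+ (a ℕ.+ b)) 0 ℚᵘ.≃ ℚᵘ.mkℚᵘ (ℤ.+ a) 0 ℚᵘ.+ ℚᵘ.mkℚᵘ (ℤ.+ b) 0
  fractions = ℚᵘ.*≡* (trans (ℤP.*-identityʳ _) (trans (ℤP.pos-+ a b)
    (sym (trans (ℤP.*-identityʳ _) (cong₂ ℤ._+_ (ℤP.*-identityʳ (ℤ.+ a)) (ℤP.*-identityʳ (ℤ.+ b)))))))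

ℕ→ℚ-* : ∀ a b → ℕ→ℚ (a ℕ.* b) ≡ ℕ→ℚ a * ℕ→ℚ b
ℕ→ℚ-* a b = ℚP.toℚᵘ-injective (ℚᵘP.≃-trans (toℚᵘ-ℕ→ℚ (a ℕ.* b))
  (ℚᵘP.≃-trans fractions (ℚᵘP.≃-sym (ℚᵘP.≃-trans (ℚP.toℚᵘ-homo-* (ℕ→ℚ a) (ℕ→ℚ b))
                                                  (ℚᵘP.*-cong (toℚᵘ-ℕ→ℚ a) (toℚᵘ-ℕ→ℚ b))))))
  where
  fractions : ℚᵘ.mkℚᵘ (ℤ.+ (a ℕ.* b)) 0 ℚᵘ.≃ ℚᵘ.mkℚᵘ (ℤ.+ a) 0 ℚᵘ.* ℚᵘ.mkℚᵘ (ℤ.+ b) 0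
  fractions = ℚᵘ.*≡* (trans (ℤP.*-identityʳ _) (trans (ℤP.pos-* a b) (sym (ℤP.*-identityʳ _))))

1/d*d≡1 : ∀ d .{{_ : ℕ.NonZero d}} → (ℤ.+ 1 / d) * ℕ→ℚ d ≡ 1ℚ
1/d*d≡1 (suc d) = ℚP.toℚᵘ-injective (ℚᵘP.≃-trans (ℚP.toℚᵘ-homo-* (ℤ.+ 1 / suc d) (ℕ→ℚ (suc d)))
  (ℚᵘP.≃-trans (ℚᵘP.*-cong (ℚP.toℚᵘ-fromℚᵘ (ℚᵘ.mkℚᵘ (ℤ.+ 1) d)) (toℚᵘ-ℕ→ℚ (suc d)))
    (ℚᵘ.*≡* (cong (λ x → ℤ.+ suc x) (trans (ℕP.*-identityʳ (d ℕ.+ 0)) (cong (ℕ._+ 0) (sym (ℕP.*-identityʳ d))))))))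

inv!-inverse : ∀ n → inv! n * ℕ→ℚ (n !) ≡ 1ℚ
inv!-inverse n = 1/d*d≡1 (n !) {{n ℕP.!≢0}}

inv!-suc : ∀ a → ℕ→ℚ (suc a) * inv! (suc a) ≡ inv! a
inv!-suc a = begin
  sa * is                   ≡⟨ ℚP.*-identityʳ _ ⟨
  sa * is * 1ℚ              ≡⟨ cong (sa * is *_) (inv!-inverse a) ⟨
  sa * is * (ia * fa)       ≡⟨ solve 4 (λ sa is ia fa → sa :* is :* (ia :* fa) := ia :* (is :* (sa :* fa))) refl sa is ia fa ⟩
  ia * (is * (sa * fa))     ≡⟨ cong (λ z → ia * (is * z)) (ℕ→ℚ-* (suc a) (a !)) ⟨
  ia * (is * ℕ→ℚ (suc a !)) ≡⟨ cong (ia *_) (inv!-inverse (suc a)) ⟩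
  ia * 1ℚ                   ≡⟨ ℚP.*-identityʳ ia ⟩
  ia                        ∎
  where
  open ≡-Reasoning
  sa is ia fa : ℚ
  sa = ℕ→ℚ (suc a); is = inv! (suc a); ia = inv! a; fa = ℕ→ℚ (a !)

-- `when b x` is x if b holds and 0 otherwise; all summation constraints
-- are carried by such indicators.  Indicators of conjunctions nest, commute,
-- absorb constant factors and annihilate 0.
when : Bool → ℚ → ℚ
when true  x = x
when false _ = 0ℚ

when-∧ : ∀ b c x → when (b ∧ c) x ≡ when b (when c x)
when-∧ true  c x = refl
when-∧ false c x = refl

when-*ˡ : ∀ b x y → x * when b y ≡ when b (x * y)
when-*ˡ true  x y = refl
when-*ˡ false x y = ℚP.*-zeroʳ x

when-swap : ∀ b c x → when b (when c x) ≡ when c (when b x)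
when-swap true  c     x = refl
when-swap false true  x = refl
when-swap false false x = refl

when-0 : ∀ b → when b 0ℚ ≡ 0ℚ
when-0 true  = refl
when-0 false = refl

when²-*ˡ : ∀ b₁ b₂ c x → when b₁ (when b₂ (c * x)) ≡ c * when b₁ (when b₂ x)
when²-*ˡ b₁ b₂ c x = sym (trans (when-*ˡ b₁ c _) (cong (when b₁) (when-*ˡ b₂ c x)))

when³-*ˡ : ∀ b₁ b₂ b₃ c x → when b₁ (when b₂ (when b₃ (c * x))) ≡ c * when b₁ (when b₂ (when b₃ x))
when³-*ˡ b₁ b₂ b₃ c x = trans (cong (λ z → when b₁ (when b₂ z)) (sym (when-*ˡ b₃ c x))) (when²-*ˡ b₁ b₂ c _)

-- Boolean order, by recursion on both arguments so that it computes on
-- successor patterns (unlike the library's `_≤ᵇ_`, which goes through `_<ᵇ_`),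
-- with its reflection of `_≤_`.
infix 5 _≤ᵇ_
_≤ᵇ_ : ℕ → ℕ → Bool
zero  ≤ᵇ _     = true
suc m ≤ᵇ zero  = false
suc m ≤ᵇ suc n = m ≤ᵇ n

≤ᵇ⇒≤ : ∀ m n → m ≤ᵇ n ≡ true → m ≤ n
≤ᵇ⇒≤ zero    n       _ = z≤n
≤ᵇ⇒≤ (suc m) (suc n) h = s≤s (≤ᵇ⇒≤ m n h)

≤⇒≤ᵇ : ∀ {m n} → m ≤ n → m ≤ᵇ n ≡ true
≤⇒≤ᵇ {zero}              _       = refl
≤⇒≤ᵇ {suc m} {suc n} (s≤s h) = ≤⇒≤ᵇ h

>⇒≤ᵇ-false : ∀ {m n} → n < m → m ≤ᵇ n ≡ false
>⇒≤ᵇ-false {suc m} {zero}  _       = refl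
>⇒≤ᵇ-false {suc m} {suc n} (s≤s h) = >⇒≤ᵇ-false h

≤ᵇ-false⇒> : ∀ m n → m ≤ᵇ n ≡ false → n < m
≤ᵇ-false⇒> (suc m) zero    _ = s≤s z≤n
≤ᵇ-false⇒> (suc m) (suc n) h = s≤s (≤ᵇ-false⇒> m n h)

≡ᵇ-false : ∀ m n → m < n → (m ℕ.≡ᵇ n) ≡ false
≡ᵇ-false zero    (suc n) _       = refl
≡ᵇ-false (suc m) (suc n) (s≤s h) = ≡ᵇ-false m n h

+≡ᵇ : ∀ a s μ → (a ℕ.+ s ℕ.≡ᵇ μ) ≡ ((a ≤ᵇ μ) ∧ (s ℕ.≡ᵇ μ ∸ a))
+≡ᵇ zero    s μ       = refl
+≡ᵇ (suc a) s zero    = refl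
+≡ᵇ (suc a) s (suc μ) = +≡ᵇ a s μ

when-+≡ᵇ : ∀ a s μ x → when (a ℕ.+ s ℕ.≡ᵇ μ) x ≡ when (a ≤ᵇ μ) (when (s ℕ.≡ᵇ μ ∸ a) x)
when-+≡ᵇ a s μ x = trans (cong (λ b → when b x) (+≡ᵇ a s μ)) (when-∧ (a ≤ᵇ μ) _ x)

when-≤ᵇ-+ : ∀ q r ν x → when (q ≤ᵇ ν) (when (r ≤ᵇ ν ∸ q) x) ≡ when (q ℕ.+ r ≤ᵇ ν) x
when-≤ᵇ-+ zero    r ν       x = refl
when-≤ᵇ-+ (suc q) r zero    x = refl
when-≤ᵇ-+ (suc q) r (suc ν) x = when-≤ᵇ-+ q r ν x

sumBelow : ℕ → (ℕ → ℚ) → ℚ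
sumBelow zero    f = 0ℚ
sumBelow (suc n) f = f 0 + sumBelow n (λ a → f (suc a))

sumBelow-cong : ∀ n {f g : ℕ → ℚ} → (∀ a → a < n → f a ≡ g a) → sumBelow n f ≡ sumBelow n g
sumBelow-cong zero    h = refl
sumBelow-cong (suc n) h = cong₂ _+_ (h 0 (s≤s z≤n)) (sumBelow-cong n (λ a a<n → h (suc a) (s≤s a<n)))

sumBelow-0 : ∀ n {f} → (∀ a → a < n → f a ≡ 0ℚ) → sumBelow n f ≡ 0ℚ
sumBelow-0 zero    h = refl
sumBelow-0 (suc n) h = trans (cong₂ _+_ (h 0 (s≤s z≤n)) (sumBelow-0 n (λ a a<n → h (suc a) (s≤s a<n)))) (ℚP.+-identityˡ 0ℚ)

sumBelow-+ : ∀ n f g → sumBelow n (λ a → f a + g a) ≡ sumBelow n f + sumBelow n g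
sumBelow-+ zero    f g = sym (ℚP.+-identityˡ 0ℚ)
sumBelow-+ (suc n) f g = trans (cong ((f 0 + g 0) +_) (sumBelow-+ n _ _))
  (solve 4 (λ a b c d → a :+ b :+ (c :+ d) := a :+ c :+ (b :+ d)) refl (f 0) (g 0) _ _)

sumBelow-*ˡ : ∀ n c f → sumBelow n (λ a → c * f a) ≡ c * sumBelow n f
sumBelow-*ˡ zero    c f = sym (ℚP.*-zeroʳ c)
sumBelow-*ˡ (suc n) c f = trans (cong ((c * f 0) +_) (sumBelow-*ˡ n c _)) (sym (ℚP.*-distribˡ-+ c _ _))

sumBelow-when : ∀ n b f → sumBelow n (λ a → when b (f a)) ≡ when b (sumBelow n f)
sumBelow-when n true  f = refl
sumBelow-when n false f = sumBelow-0 n (λ _ _ → refl)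

sumBelow-last : ∀ n f → sumBelow (suc n) f ≡ sumBelow n f + f n
sumBelow-last zero    f = trans (ℚP.+-identityʳ (f 0)) (sym (ℚP.+-identityˡ (f 0)))
sumBelow-last (suc n) f = trans (cong (f 0 +_) (sumBelow-last n (λ a → f (suc a))))
  (sym (ℚP.+-assoc (f 0) (sumBelow n (λ a → f (suc a))) (f (suc n))))

sumBelow-swap : ∀ n m (f : ℕ → ℕ → ℚ) →
  sumBelow n (λ a → sumBelow m (f a)) ≡ sumBelow m (λ b → sumBelow n (λ a → f a b))
sumBelow-swap zero    m f = sym (sumBelow-0 m (λ _ _ → refl))
sumBelow-swap (suc n) m f = trans (cong (sumBelow m (f 0) +_) (sumBelow-swap n m _)) (sym (sumBelow-+ m _ _))

sumBelow-trunc : ∀ μ d f → (∀ a → μ ≤ a → f a ≡ 0ℚ) → sumBelow (μ ℕ.+ d) f ≡ sumBelow μ f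
sumBelow-trunc zero    d f h = sumBelow-0 d (λ a _ → h a z≤n)
sumBelow-trunc (suc μ) d f h = cong (f 0 +_) (sumBelow-trunc μ d _ (λ a μ≤a → h (suc a) (s≤s μ≤a)))

sumBelow-guarded : ∀ μ M g → μ ≤ M → sumBelow M (λ a → when (suc a ≤ᵇ μ) (g a)) ≡ sumBelow μ g
sumBelow-guarded μ M g μ≤M = begin
  sumBelow M guarded                 ≡⟨ cong (λ z → sumBelow z guarded) (sym (ℕP.m+[n∸m]≡n μ≤M)) ⟩
  sumBelow (μ ℕ.+ (M ∸ μ)) guarded   ≡⟨ sumBelow-trunc μ (M ∸ μ) _ (λ a μ≤a → cong (λ b → when b (g a)) (>⇒≤ᵇ-false (s≤s μ≤a))) ⟩
  sumBelow μ guarded                 ≡⟨ sumBelow-cong μ (λ a a<μ → cong (λ b → when b (g a)) (≤⇒≤ᵇ a<μ)) ⟩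
  sumBelow μ g                       ∎
  where
  open ≡-Reasoning
  guarded : ℕ → ℚ
  guarded a = when (suc a ≤ᵇ μ) (g a)

qsum-cong : ∀ {A : Set} (L : List A) {f g : A → ℚ} → (∀ v → f v ≡ g v) → qsum (map f L) ≡ qsum (map g L)
qsum-cong []      h = refl
qsum-cong (x ∷ L) h = cong₂ _+_ (h x) (qsum-cong L h)

qsum-0 : ∀ {A : Set} (L : List A) {f : A → ℚ} → (∀ v → f v ≡ 0ℚ) → qsum (map f L) ≡ 0ℚ
qsum-0 []      h = refl
qsum-0 (x ∷ L) h = trans (cong₂ _+_ (h x) (qsum-0 L h)) (ℚP.+-identityˡ 0ℚ)

qsum-*ˡ : ∀ {A : Set} (L : List A) c (f : A → ℚ) → qsum (map (λ v → c * f v) L) ≡ c * qsum (map f L)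
qsum-*ˡ []      c f = sym (ℚP.*-zeroʳ c)
qsum-*ˡ (x ∷ L) c f = trans (cong ((c * f x) +_) (qsum-*ˡ L c f)) (sym (ℚP.*-distribˡ-+ c _ _))

qsum-when : ∀ {A : Set} (L : List A) b (f : A → ℚ) → qsum (map (λ v → when b (f v)) L) ≡ when b (qsum (map f L))
qsum-when L true  f = refl
qsum-when L false f = qsum-0 L (λ _ → refl)

qsum-filter : ∀ {A : Set} (L : List A) (p : A → Bool) (f : A → ℚ) →
  qsum (map f (filterᵇ p L)) ≡ qsum (map (λ v → when (p v) (f v)) L)
qsum-filter []      p f = refl
qsum-filter (x ∷ L) p f with p x
... | true  = cong (f x +_) (qsum-filter L p f)
... | false = trans (qsum-filter L p f) (sym (ℚP.+-identityˡ _))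

qsum-++ : ∀ {A : Set} (L R : List A) (f : A → ℚ) → qsum (map f (L ++ R)) ≡ qsum (map f L) + qsum (map f R)
qsum-++ []      R f = sym (ℚP.+-identityˡ _)
qsum-++ (x ∷ L) R f = trans (cong (f x +_) (qsum-++ L R f)) (sym (ℚP.+-assoc (f x) (qsum (map f L)) (qsum (map f R))))

qsum-map : ∀ {A B : Set} (L : List A) (g : A → B) (f : B → ℚ) → qsum (map f (map g L)) ≡ qsum (map (λ v → f (g v)) L)
qsum-map []      g f = refl
qsum-map (x ∷ L) g f = cong (f (g x) +_) (qsum-map L g f)

qsum-concatMap : ∀ {A B : Set} (L : List A) (h : A → List B) (f : B → ℚ) →
  qsum (map f (concatMap h L)) ≡ qsum (map (λ a → qsum (map f (h a))) L)
qsum-concatMap []      h f = refl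
qsum-concatMap (x ∷ L) h f = trans (qsum-++ (h x) (concatMap h L) f) (cong (qsum (map f (h x)) +_) (qsum-concatMap L h f))

qsum-applyUpTo : ∀ n (h : ℕ → ℕ) (f : ℕ → ℚ) → qsum (map f (applyUpTo h n)) ≡ sumBelow n (λ a → f (h a))
qsum-applyUpTo zero    h f = refl
qsum-applyUpTo (suc n) h f = cong (f (h 0) +_) (qsum-applyUpTo n (λ a → h (suc a)) f)

qsum-allVecs-suc : ∀ M J (g : Vec ℕ (suc J) → ℚ) →
  qsum (map g (allVecs M (suc J))) ≡ sumBelow (suc M) (λ a → qsum (map (λ w → g (a Vec.∷ w)) (allVecs M J)))
qsum-allVecs-suc M J g = trans (qsum-concatMap (upTo (suc M)) (λ a → map (a Vec.∷_) (allVecs M J)) g)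
  (trans (qsum-applyUpTo (suc M) (λ a → a) (λ a → qsum (map g (map (a Vec.∷_) (allVecs M J)))))
         (sumBelow-cong (suc M) (λ a _ → qsum-map (allVecs M J) (a Vec.∷_) g)))

-- compPoly x μ n = Σ over compositions (a₁,…,aₙ) of μ into positive parts
-- of x_{a₁}⋯x_{aₙ}, by recursion on the first part a₁ = a + 1.
compPoly : (ℕ → ℚ) → ℕ → ℕ → ℚ
compPoly x μ zero    = when (μ ℕ.≡ᵇ 0) 1ℚ
compPoly x μ (suc n) = sumBelow μ (λ a → x (suc a) * compPoly x (μ ∸ suc a) n)

expTerm : (ℕ → ℚ) → ℕ → ℕ → ℚ
expTerm x p a = (x p ^ℚ a) * inv! a

expTerm-raise : ∀ x p a y → x p * (expTerm x p a * y) ≡ ℕ→ℚ (suc a) * (expTerm x p (suc a) * y)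
expTerm-raise x p a y = begin
  xp * ((xpa * ia) * y)          ≡⟨ cong (λ z → xp * ((xpa * z) * y)) (sym (inv!-suc a)) ⟩
  xp * ((xpa * (sa * is)) * y)   ≡⟨ solve 5 (λ xp xpa sa is y → xp :* ((xpa :* (sa :* is)) :* y) := sa :* ((xp :* xpa) :* is :* y)) refl xp xpa sa is y ⟩
  sa * ((xp * xpa) * is * y)     ∎
  where
  open ≡-Reasoning
  xp xpa ia sa is : ℚ
  xp = x p; xpa = x p ^ℚ a; ia = inv! a; sa = ℕ→ℚ (suc a); is = inv! (suc a)

split-≤ : ∀ a r y → ℕ→ℚ r * when (a ≤ᵇ r) y ≡ ℕ→ℚ a * when (a ≤ᵇ r) y + ℕ→ℚ (r ∸ a) * when (a ≤ᵇ r) y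
split-≤ a r y with a ≤ᵇ r in a≤r
... | true  = trans (cong (λ z → ℕ→ℚ z * y) (sym (ℕP.m+[n∸m]≡n (≤ᵇ⇒≤ a r a≤r))))
                    (trans (cong (_* y) (ℕ→ℚ-+ a (r ∸ a))) (ℚP.*-distribʳ-+ y (ℕ→ℚ a) (ℕ→ℚ (r ∸ a))))
... | false = trans (ℚP.*-zeroʳ (ℕ→ℚ r))
                    (sym (trans (cong₂ _+_ (ℚP.*-zeroʳ (ℕ→ℚ a)) (ℚP.*-zeroʳ (ℕ→ℚ (r ∸ a)))) (ℚP.+-identityˡ 0ℚ)))

module Multiplicities (x : ℕ → ℚ) (B : ℕ) where

  mutual
    -- multSum p L ν ρ = Σ ∏ᵢ x_i^{rᵢ}/rᵢ! over multiplicity vectors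
    -- (r_p,…,r_{p+L-1}) ∈ {0..B}^L with Σ rᵢ = ρ and Σ i·rᵢ = ν.
    multSum : (p L ν ρ : ℕ) → ℚ
    multSum p zero    ν ρ = when (ν ℕ.≡ᵇ 0) (when (ρ ℕ.≡ᵇ 0) 1ℚ)
    multSum p (suc L) ν ρ = sumBelow (suc B) (slice p L ν ρ)

    slice : (p L ν ρ a : ℕ) → ℚ
    slice p L ν ρ a = when (a ≤ᵇ ρ) (when (p ℕ.* a ≤ᵇ ν) (expTerm x p a * multSum (suc p) L (ν ∸ p ℕ.* a) (ρ ∸ a)))

  expTerm-0 : ∀ p y → expTerm x p 0 * y ≡ y
  expTerm-0 p y = trans (cong (_* y) (ℚP.*-identityˡ 1ℚ)) (ℚP.*-identityˡ y)

  -- If ν < p no index fits into ν: only the zero multiplicity vector remains.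
  multSum-small : ∀ L p ν ρ → ν < p → multSum p L ν ρ ≡ multSum p 0 ν ρ
  multSum-small zero    p ν ρ _   = refl
  multSum-small (suc L) p ν ρ ν<p = begin
    slice p L ν ρ 0 + sumBelow B (λ a → slice p L ν ρ (suc a))
      ≡⟨ cong₂ _+_ zeroSlice (sumBelow-0 B (λ a _ → positiveSlice a)) ⟩
    multSum p 0 ν ρ + 0ℚ
      ≡⟨ ℚP.+-identityʳ _ ⟩
    multSum p 0 ν ρ ∎
    where
    open ≡-Reasoning
    zeroSlice : when (p ℕ.* 0 ≤ᵇ ν) (expTerm x p 0 * multSum (suc p) L (ν ∸ p ℕ.* 0) ρ) ≡ multSum p 0 ν ρ
    zeroSlice rewrite ℕP.*-zeroʳ p = trans (expTerm-0 p _) (multSum-small L (suc p) ν ρ (ℕP.m≤n⇒m≤1+n ν<p))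
    positiveSlice : ∀ a → slice p L ν ρ (suc a) ≡ 0ℚ
    positiveSlice a rewrite >⇒≤ᵇ-false {p ℕ.* suc a} {ν} (ℕP.<-≤-trans ν<p (ℕP.m≤m*n p (suc a))) = when-0 (suc a ≤ᵇ ρ)

  multSum-extend : ∀ L d p ν ρ → ν < p ℕ.+ L → multSum p (L ℕ.+ d) ν ρ ≡ multSum p L ν ρ
  multSum-extend zero    d p ν ρ h = multSum-small d p ν ρ (subst (ν <_) (ℕP.+-identityʳ p) h)
  multSum-extend (suc L) d p ν ρ h = sumBelow-cong (suc B) (λ a _ →
    cong (λ z → when (a ≤ᵇ ρ) (when (p ℕ.* a ≤ᵇ ν) (expTerm x p a * z)))
         (multSum-extend L d (suc p) (ν ∸ p ℕ.* a) (ρ ∸ a)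
            (ℕP.≤-<-trans (ℕP.m∸n≤m ν (p ℕ.* a)) (subst (ν <_) (ℕP.+-suc p L) h))))

  multSum-ρ0 : ∀ L p ν → multSum p L ν 0 ≡ when (ν ℕ.≡ᵇ 0) 1ℚ
  multSum-ρ0 zero    p ν = refl
  multSum-ρ0 (suc L) p ν = begin
    slice p L ν 0 0 + sumBelow B (λ a → slice p L ν 0 (suc a))
      ≡⟨ cong₂ _+_ zeroSlice (sumBelow-0 B (λ a _ → refl)) ⟩
    when (ν ℕ.≡ᵇ 0) 1ℚ + 0ℚ
      ≡⟨ ℚP.+-identityʳ _ ⟩
    when (ν ℕ.≡ᵇ 0) 1ℚ ∎
    where
    open ≡-Reasoning
    zeroSlice : when (p ℕ.* 0 ≤ᵇ ν) (expTerm x p 0 * multSum (suc p) L (ν ∸ p ℕ.* 0) 0) ≡ when (ν ℕ.≡ᵇ 0) 1ℚ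
    zeroSlice rewrite ℕP.*-zeroʳ p = trans (expTerm-0 p _) (multSum-ρ0 L (suc p) ν)

  -- The term of the marking recurrence in which the marked part is the index p+i.
  markTerm : (p L ν ρ i : ℕ) → ℚ
  markTerm p L ν ρ i = when (p ℕ.+ i ≤ᵇ ν) (x (p ℕ.+ i) * multSum p L (ν ∸ (p ℕ.+ i)) ρ)

  markedSum : (p L ν ρ : ℕ) → ℚ
  markedSum p L ν ρ = sumBelow L (markTerm p L ν ρ)

  -- Marking a part equal to p: a · x_p^a/a! = x_p · x_p^{a-1}/(a-1)!.
  mark-first : ∀ p L ν ρ → 1 ≤ p → ν ≤ B →
    markTerm p (suc L) ν ρ 0 ≡ sumBelow (suc B) (λ a → ℕ→ℚ a * slice p L ν (suc ρ) a)
  mark-first p L ν ρ 1≤p ν≤B = begin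
    markTerm p (suc L) ν ρ 0
      ≡⟨ cong (λ q → when (q ≤ᵇ ν) (x q * multSum p (suc L) (ν ∸ q) ρ)) (ℕP.+-identityʳ p) ⟩
    when (p ≤ᵇ ν) (x p * sumBelow (suc B) (slice p L (ν ∸ p) ρ))
      ≡⟨ cong (when (p ≤ᵇ ν)) (sym (sumBelow-*ˡ (suc B) (x p) (slice p L (ν ∸ p) ρ))) ⟩
    when (p ≤ᵇ ν) (sumBelow (suc B) (λ a → x p * slice p L (ν ∸ p) ρ a))
      ≡⟨ sym (sumBelow-when (suc B) (p ≤ᵇ ν) (λ a → x p * slice p L (ν ∸ p) ρ a)) ⟩
    sumBelow (suc B) (λ a → when (p ≤ᵇ ν) (x p * slice p L (ν ∸ p) ρ a))
      ≡⟨ sumBelow-cong (suc B) (λ a _ → raise a) ⟩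
    sumBelow (suc B) (λ a → marked (suc a))
      ≡⟨ sym (trans (cong (_+ sumBelow (suc B) (λ a → marked (suc a))) (ℚP.*-zeroˡ (slice p L ν (suc ρ) 0))) (ℚP.+-identityˡ _)) ⟩
    sumBelow (suc (suc B)) marked
      ≡⟨ sumBelow-last (suc B) marked ⟩
    sumBelow (suc B) marked + marked (suc B)
      ≡⟨ trans (cong (sumBelow (suc B) marked +_) tooLarge) (ℚP.+-identityʳ _) ⟩
    sumBelow (suc B) marked ∎
    where
    open ≡-Reasoning
    marked : ℕ → ℚ
    marked a = ℕ→ℚ a * slice p L ν (suc ρ) a

    raise : ∀ a → when (p ≤ᵇ ν) (x p * slice p L (ν ∸ p) ρ a) ≡ marked (suc a)
    raise a = begin
      when (p ≤ᵇ ν) (x p * when (a ≤ᵇ ρ) W)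
        ≡⟨ cong (when (p ≤ᵇ ν)) (when-*ˡ (a ≤ᵇ ρ) (x p) W) ⟩
      when (p ≤ᵇ ν) (when (a ≤ᵇ ρ) (x p * W))
        ≡⟨ when-swap (p ≤ᵇ ν) (a ≤ᵇ ρ) _ ⟩
      when (a ≤ᵇ ρ) (when (p ≤ᵇ ν) (x p * W))
        ≡⟨ cong (λ z → when (a ≤ᵇ ρ) (when (p ≤ᵇ ν) z)) (when-*ˡ (p ℕ.* a ≤ᵇ ν ∸ p) (x p) V) ⟩
      when (a ≤ᵇ ρ) (when (p ≤ᵇ ν) (when (p ℕ.* a ≤ᵇ ν ∸ p) (x p * V)))
        ≡⟨ cong (when (a ≤ᵇ ρ)) (when-≤ᵇ-+ p (p ℕ.* a) ν _) ⟩
      when (a ≤ᵇ ρ) (when (p ℕ.+ p ℕ.* a ≤ᵇ ν) (x p * V))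
        ≡⟨ cong (λ z → when (a ≤ᵇ ρ) (when (p ℕ.+ p ℕ.* a ≤ᵇ ν) z)) (expTerm-raise x p a _) ⟩
      when (a ≤ᵇ ρ) (when (p ℕ.+ p ℕ.* a ≤ᵇ ν) (ℕ→ℚ (suc a) * (expTerm x p (suc a) * multSum (suc p) L ((ν ∸ p) ∸ p ℕ.* a) (ρ ∸ a))))
        ≡⟨ cong₂ (λ u w → when (a ≤ᵇ ρ) (when (u ≤ᵇ ν) (ℕ→ℚ (suc a) * (expTerm x p (suc a) * multSum (suc p) L w (ρ ∸ a)))))
                 (sym (ℕP.*-suc p a)) (trans (ℕP.∸-+-assoc ν p (p ℕ.* a)) (cong (ν ∸_) (sym (ℕP.*-suc p a)))) ⟩
      when (a ≤ᵇ ρ) (when (p ℕ.* suc a ≤ᵇ ν) (ℕ→ℚ (suc a) * Y))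
        ≡⟨ when²-*ˡ (a ≤ᵇ ρ) (p ℕ.* suc a ≤ᵇ ν) (ℕ→ℚ (suc a)) Y ⟩
      marked (suc a) ∎
      where
      V W Y : ℚ
      V = expTerm x p a * multSum (suc p) L ((ν ∸ p) ∸ p ℕ.* a) (ρ ∸ a)
      W = when (p ℕ.* a ≤ᵇ ν ∸ p) V
      Y = expTerm x p (suc a) * multSum (suc p) L (ν ∸ p ℕ.* suc a) (ρ ∸ a)

    -- multiplicity B+1 of a positive index already exceeds ν ≤ B
    tooLarge : marked (suc B) ≡ 0ℚ
    tooLarge rewrite >⇒≤ᵇ-false {p ℕ.* suc B} {ν} (ℕP.<-≤-trans (s≤s ν≤B)
                       (subst (ℕ._≤ p ℕ.* suc B) (ℕP.*-identityˡ (suc B)) (ℕP.*-monoˡ-≤ (suc B) 1≤p))) =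
      trans (cong (ℕ→ℚ (suc B) *_) (when-0 (suc B ≤ᵇ suc ρ))) (ℚP.*-zeroʳ (ℕ→ℚ (suc B)))

  later-reorder : ∀ p L ν ρ i a →
    when (p ℕ.+ suc i ≤ᵇ ν) (x (p ℕ.+ suc i) * slice p L (ν ∸ (p ℕ.+ suc i)) ρ a)
      ≡ when (a ≤ᵇ ρ) (when (p ℕ.* a ≤ᵇ ν) (expTerm x p a * markTerm (suc p) L (ν ∸ p ℕ.* a) (ρ ∸ a) i))
  later-reorder p L ν ρ i a = begin
    when (p ℕ.+ suc i ≤ᵇ ν) (x (p ℕ.+ suc i) * when (a ≤ᵇ ρ) (when (pa ≤ᵇ ν ∸ (p ℕ.+ suc i)) (c * Q ((ν ∸ (p ℕ.+ suc i)) ∸ pa))))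
      ≡⟨ cong (λ q → when (q ≤ᵇ ν) (x q * when (a ≤ᵇ ρ) (when (pa ≤ᵇ ν ∸ q) (c * Q ((ν ∸ q) ∸ pa))))) (ℕP.+-suc p i) ⟩
    when (q ≤ᵇ ν) (x q * when (a ≤ᵇ ρ) (when (pa ≤ᵇ ν ∸ q) V))
      ≡⟨ cong (when (q ≤ᵇ ν)) (when-*ˡ (a ≤ᵇ ρ) (x q) _) ⟩
    when (q ≤ᵇ ν) (when (a ≤ᵇ ρ) (x q * when (pa ≤ᵇ ν ∸ q) V))
      ≡⟨ when-swap (q ≤ᵇ ν) (a ≤ᵇ ρ) _ ⟩
    when (a ≤ᵇ ρ) (when (q ≤ᵇ ν) (x q * when (pa ≤ᵇ ν ∸ q) V))
      ≡⟨ cong (λ z → when (a ≤ᵇ ρ) (when (q ≤ᵇ ν) z)) (when-*ˡ (pa ≤ᵇ ν ∸ q) (x q) V) ⟩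
    when (a ≤ᵇ ρ) (when (q ≤ᵇ ν) (when (pa ≤ᵇ ν ∸ q) (x q * V)))
      ≡⟨ cong (when (a ≤ᵇ ρ)) (when-≤ᵇ-+ q pa ν _) ⟩
    when (a ≤ᵇ ρ) (when (q ℕ.+ pa ≤ᵇ ν) (x q * V))
      ≡⟨ cong₂ (λ u w → when (a ≤ᵇ ρ) (when (u ≤ᵇ ν) w)) (ℕP.+-comm q pa)
           (trans (cong (λ w → x q * (c * Q w)) reorder)
                  (solve 3 (λ X C R → X :* (C :* R) := C :* (X :* R)) refl (x q) c _)) ⟩
    when (a ≤ᵇ ρ) (when (pa ℕ.+ q ≤ᵇ ν) (c * (x q * Q ((ν ∸ pa) ∸ q))))
      ≡⟨ cong (when (a ≤ᵇ ρ)) (sym (when-≤ᵇ-+ pa q ν _)) ⟩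
    when (a ≤ᵇ ρ) (when (pa ≤ᵇ ν) (when (q ≤ᵇ ν ∸ pa) (c * (x q * Q ((ν ∸ pa) ∸ q)))))
      ≡⟨ cong (λ z → when (a ≤ᵇ ρ) (when (pa ≤ᵇ ν) z)) (sym (when-*ˡ (q ≤ᵇ ν ∸ pa) c _)) ⟩
    when (a ≤ᵇ ρ) (when (pa ≤ᵇ ν) (c * markTerm (suc p) L (ν ∸ pa) (ρ ∸ a) i)) ∎
    where
    open ≡-Reasoning
    pa q : ℕ
    pa = p ℕ.* a
    q  = suc p ℕ.+ i
    c : ℚ
    c  = expTerm x p a
    Q : ℕ → ℚ
    Q ν′ = multSum (suc p) L ν′ (ρ ∸ a)
    V : ℚ
    V = c * Q ((ν ∸ q) ∸ pa)
    reorder : (ν ∸ q) ∸ pa ≡ (ν ∸ pa) ∸ q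
    reorder = trans (ℕP.∸-+-assoc ν q pa) (trans (cong (ν ∸_) (ℕP.+-comm q pa)) (sym (ℕP.∸-+-assoc ν pa q)))

  -- (ρ-a)+1 = (ρ+1)-a when a ≤ ρ; when a > ρ both sides vanish.
  restore-weight : ∀ p L ν ρ a →
    when (a ≤ᵇ ρ) (when (p ℕ.* a ≤ᵇ ν) (expTerm x p a * (ℕ→ℚ (suc (ρ ∸ a)) * multSum (suc p) L (ν ∸ p ℕ.* a) (suc (ρ ∸ a)))))
      ≡ ℕ→ℚ (suc ρ ∸ a) * slice p L ν (suc ρ) a
  restore-weight p L ν ρ a with a ≤ᵇ ρ in a≤ρ
  ... | true rewrite ℕP.+-∸-assoc 1 (≤ᵇ⇒≤ a ρ a≤ρ) | ≤⇒≤ᵇ {a} {suc ρ} (ℕP.m≤n⇒m≤1+n (≤ᵇ⇒≤ a ρ a≤ρ)) =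
    trans (cong (when (p ℕ.* a ≤ᵇ ν)) (solve 3 (λ C s R → C :* (s :* R) := s :* (C :* R)) refl (expTerm x p a) (ℕ→ℚ (suc (ρ ∸ a))) _))
          (sym (when-*ˡ (p ℕ.* a ≤ᵇ ν) (ℕ→ℚ (suc (ρ ∸ a))) _))
  ... | false = sym (trans (cong (λ n → ℕ→ℚ n * slice p L ν (suc ρ) a) (ℕP.m≤n⇒m∸n≡0 (≤ᵇ-false⇒> a ρ a≤ρ)))
                            (ℚP.*-zeroˡ (slice p L ν (suc ρ) a)))

  -- Marking an index p+1+i > p, using the recurrence one index further.
  mark-later : ∀ p L ν ρ → ν ≤ B →
    (∀ ν′ ρ′ → ν′ ≤ B → ℕ→ℚ (suc ρ′) * multSum (suc p) L ν′ (suc ρ′) ≡ markedSum (suc p) L ν′ ρ′) →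
    sumBelow L (λ i → markTerm p (suc L) ν ρ (suc i)) ≡ sumBelow (suc B) (λ a → ℕ→ℚ (suc ρ ∸ a) * slice p L ν (suc ρ) a)
  mark-later p L ν ρ ν≤B mark = begin
    sumBelow L (λ i → markTerm p (suc L) ν ρ (suc i))
      ≡⟨ sumBelow-cong L (λ i _ → expand i) ⟩
    sumBelow L (λ i → sumBelow (suc B) (F i))
      ≡⟨ sumBelow-swap L (suc B) F ⟩
    sumBelow (suc B) (λ a → sumBelow L (λ i → F i a))
      ≡⟨ sumBelow-cong (suc B) (λ a _ → collect a) ⟩
    sumBelow (suc B) (λ a → ℕ→ℚ (suc ρ ∸ a) * slice p L ν (suc ρ) a) ∎
    where
    open ≡-Reasoning
    F : ℕ → ℕ → ℚ
    F i a = when (p ℕ.+ suc i ≤ᵇ ν) (x (p ℕ.+ suc i) * slice p L (ν ∸ (p ℕ.+ suc i)) ρ a)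

    expand : ∀ i → markTerm p (suc L) ν ρ (suc i) ≡ sumBelow (suc B) (F i)
    expand i = trans (cong (when (p ℕ.+ suc i ≤ᵇ ν)) (sym (sumBelow-*ˡ (suc B) (x (p ℕ.+ suc i)) (slice p L (ν ∸ (p ℕ.+ suc i)) ρ))))
                     (sym (sumBelow-when (suc B) (p ℕ.+ suc i ≤ᵇ ν) (λ a → x (p ℕ.+ suc i) * slice p L (ν ∸ (p ℕ.+ suc i)) ρ a)))

    collect : ∀ a → sumBelow L (λ i → F i a) ≡ ℕ→ℚ (suc ρ ∸ a) * slice p L ν (suc ρ) a
    collect a = begin
      sumBelow L (λ i → F i a)
        ≡⟨ sumBelow-cong L (λ i _ → later-reorder p L ν ρ i a) ⟩
      sumBelow L (λ i → when (a ≤ᵇ ρ) (when (pa ≤ᵇ ν) (c * markTerm (suc p) L (ν ∸ pa) (ρ ∸ a) i)))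
        ≡⟨ trans (sumBelow-when L (a ≤ᵇ ρ) _) (cong (when (a ≤ᵇ ρ)) (sumBelow-when L (pa ≤ᵇ ν) _)) ⟩
      when (a ≤ᵇ ρ) (when (pa ≤ᵇ ν) (sumBelow L (λ i → c * markTerm (suc p) L (ν ∸ pa) (ρ ∸ a) i)))
        ≡⟨ cong (λ z → when (a ≤ᵇ ρ) (when (pa ≤ᵇ ν) z)) (sumBelow-*ˡ L c _) ⟩
      when (a ≤ᵇ ρ) (when (pa ≤ᵇ ν) (c * markedSum (suc p) L (ν ∸ pa) (ρ ∸ a)))
        ≡⟨ cong (λ z → when (a ≤ᵇ ρ) (when (pa ≤ᵇ ν) (c * z))) (sym (mark (ν ∸ pa) (ρ ∸ a) (ℕP.≤-trans (ℕP.m∸n≤m ν pa) ν≤B))) ⟩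
      when (a ≤ᵇ ρ) (when (pa ≤ᵇ ν) (c * (ℕ→ℚ (suc (ρ ∸ a)) * multSum (suc p) L (ν ∸ pa) (suc (ρ ∸ a)))))
        ≡⟨ restore-weight p L ν ρ a ⟩
      ℕ→ℚ (suc ρ ∸ a) * slice p L ν (suc ρ) a ∎
      where
      pa : ℕ
      pa = p ℕ.* a
      c : ℚ
      c  = expTerm x p a

  -- The marking recurrence: choosing which of the ρ+1 parts is marked,
  -- (ρ+1)·multSum p L ν (ρ+1) = Σᵢ x_{p+i}·multSum p L (ν-p-i) ρ.
  multSum-mark : ∀ L p ν ρ → 1 ≤ p → ν ≤ B → ℕ→ℚ (suc ρ) * multSum p L ν (suc ρ) ≡ markedSum p L ν ρ
  multSum-mark zero    p ν ρ _   _   = trans (cong (ℕ→ℚ (suc ρ) *_) (when-0 (ν ℕ.≡ᵇ 0))) (ℚP.*-zeroʳ (ℕ→ℚ (suc ρ)))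
  multSum-mark (suc L) p ν ρ 1≤p ν≤B = begin
    ℕ→ℚ (suc ρ) * sumBelow (suc B) (slice p L ν (suc ρ))
      ≡⟨ sym (sumBelow-*ˡ (suc B) (ℕ→ℚ (suc ρ)) (slice p L ν (suc ρ))) ⟩
    sumBelow (suc B) (λ a → ℕ→ℚ (suc ρ) * slice p L ν (suc ρ) a)
      ≡⟨ sumBelow-cong (suc B) (λ a _ → split-≤ a (suc ρ) (when (p ℕ.* a ≤ᵇ ν) (expTerm x p a * multSum (suc p) L (ν ∸ p ℕ.* a) (suc ρ ∸ a)))) ⟩
    sumBelow (suc B) (λ a → ℕ→ℚ a * slice p L ν (suc ρ) a + ℕ→ℚ (suc ρ ∸ a) * slice p L ν (suc ρ) a)
      ≡⟨ sumBelow-+ (suc B) (λ a → ℕ→ℚ a * slice p L ν (suc ρ) a) (λ a → ℕ→ℚ (suc ρ ∸ a) * slice p L ν (suc ρ) a) ⟩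
    sumBelow (suc B) (λ a → ℕ→ℚ a * slice p L ν (suc ρ) a) + sumBelow (suc B) (λ a → ℕ→ℚ (suc ρ ∸ a) * slice p L ν (suc ρ) a)
      ≡⟨ cong₂ _+_ (sym (mark-first p L ν ρ 1≤p ν≤B))
                   (sym (mark-later p L ν ρ ν≤B (λ ν′ ρ′ ν′≤B → multSum-mark L (suc p) ν′ ρ′ (s≤s z≤n) ν′≤B))) ⟩
    markedSum p (suc L) ν ρ ∎
    where open ≡-Reasoning

  -- Unfolding the marking recurrence ρ times: ρ!·multSum 1 ν ν ρ = compPoly x ν ρ.
  multSum-compPoly : ∀ ρ ν → ν ≤ B → ℕ→ℚ (ρ !) * multSum 1 ν ν ρ ≡ compPoly x ν ρ
  multSum-compPoly zero    ν ν≤B = trans (ℚP.*-identityˡ _) (multSum-ρ0 ν 1 ν)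
  multSum-compPoly (suc ρ) ν ν≤B = begin
    ℕ→ℚ (suc ρ ℕ.* ρ !) * multSum 1 ν ν (suc ρ)
      ≡⟨ cong (_* multSum 1 ν ν (suc ρ)) (ℕ→ℚ-* (suc ρ) (ρ !)) ⟩
    (s * f) * multSum 1 ν ν (suc ρ)
      ≡⟨ solve 3 (λ s f q → (s :* f) :* q := f :* (s :* q)) refl s f _ ⟩
    f * (s * multSum 1 ν ν (suc ρ))
      ≡⟨ cong (f *_) (multSum-mark ν 1 ν ρ (s≤s z≤n) ν≤B) ⟩
    f * markedSum 1 ν ν ρ
      ≡⟨ sym (sumBelow-*ˡ ν f _) ⟩
    sumBelow ν (λ i → f * markTerm 1 ν ν ρ i)
      ≡⟨ sumBelow-cong ν term ⟩
    sumBelow ν (λ i → x (suc i) * compPoly x (ν ∸ suc i) ρ) ∎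
    where
    open ≡-Reasoning
    s f : ℚ
    s = ℕ→ℚ (suc ρ)
    f = ℕ→ℚ (ρ !)
    term : ∀ i → i < ν → f * markTerm 1 ν ν ρ i ≡ x (suc i) * compPoly x (ν ∸ suc i) ρ
    term i i<ν rewrite ≤⇒≤ᵇ i<ν = begin
      f * (x (suc i) * multSum 1 ν (ν ∸ suc i) ρ)
        ≡⟨ solve 3 (λ f X q → f :* (X :* q) := X :* (f :* q)) refl f (x (suc i)) _ ⟩
      x (suc i) * (f * multSum 1 ν (ν ∸ suc i) ρ)
        ≡⟨ cong (λ z → x (suc i) * (f * z)) shrink ⟩
      x (suc i) * (f * multSum 1 (ν ∸ suc i) (ν ∸ suc i) ρ)
        ≡⟨ cong (x (suc i) *_) (multSum-compPoly ρ (ν ∸ suc i) (ℕP.≤-trans (ℕP.m∸n≤m ν (suc i)) ν≤B)) ⟩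
      x (suc i) * compPoly x (ν ∸ suc i) ρ ∎
      where
      shrink : multSum 1 ν (ν ∸ suc i) ρ ≡ multSum 1 (ν ∸ suc i) (ν ∸ suc i) ρ
      shrink = trans (cong (λ z → multSum 1 z (ν ∸ suc i) ρ) (sym (ℕP.m∸n+n≡m i<ν)))
                     (multSum-extend (ν ∸ suc i) (suc i) 1 (ν ∸ suc i) ρ (ℕP.n<1+n _))

  termOf : ℕ × ℕ → ℚ
  termOf (i , a) = expTerm x i a

indexFrom : ℕ → List ℕ → List (ℕ × ℕ)
indexFrom p []      = []
indexFrom p (a ∷ L) = (p , a) ∷ indexFrom (suc p) L

-- Defs' `indexed` is indexFrom 1 (generalised over the labelling for induction).
zip-tabulate≡indexFrom : ∀ {n} (rs : Vec ℕ n) (label : Fin n → ℕ) p → (∀ i → label i ≡ p ℕ.+ toℕ i) →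
  Vec.toList (Vec.zip (Vec.tabulate label) rs) ≡ indexFrom p (Vec.toList rs)
zip-tabulate≡indexFrom Vec.[]       label p e = refl
zip-tabulate≡indexFrom (a Vec.∷ rs) label p e =
  cong₂ _∷_ (cong (_, a) (trans (e Fin.zero) (ℕP.+-identityʳ p)))
            (zip-tabulate≡indexFrom rs (λ i → label (Fin.suc i)) (suc p) (λ i → trans (e (Fin.suc i)) (ℕP.+-suc p (toℕ i))))

qprod-cong : ∀ {A : Set} (L : List A) {f g : A → ℚ} → (∀ v → f v ≡ g v) → qprod (map f L) ≡ qprod (map g L)
qprod-cong []      h = refl
qprod-cong (x ∷ L) h = cong₂ _*_ (h x) (qprod-cong L h)

module Enumerated (x : ℕ → ℚ) (B : ℕ) (w : ℕ × ℕ → ℕ) (w-eq : ∀ i a → w (i , a) ≡ i ℕ.* a) where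
  open Multiplicities x B

  summand : ∀ {L} → ℕ → ℕ → ℕ → Vec ℕ L → ℚ
  summand p ν ρ v = when (nsum (Vec.toList v) ℕ.≡ᵇ ρ)
                      (when (nsum (map w (indexFrom p (Vec.toList v))) ℕ.≡ᵇ ν) (qprod (map termOf (indexFrom p (Vec.toList v)))))

  summand-cons : ∀ {L} p ν ρ a (v : Vec ℕ L) →
    summand p ν ρ (a Vec.∷ v) ≡ when (a ≤ᵇ ρ) (when (p ℕ.* a ≤ᵇ ν) (expTerm x p a * summand (suc p) (ν ∸ p ℕ.* a) (ρ ∸ a) v))
  summand-cons p ν ρ a v rewrite w-eq p a = begin
    when (a ℕ.+ s ℕ.≡ᵇ ρ) (when (p ℕ.* a ℕ.+ s′ ℕ.≡ᵇ ν) (c * Π))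
      ≡⟨ when-+≡ᵇ a s ρ _ ⟩
    when (a ≤ᵇ ρ) (when (s ℕ.≡ᵇ ρ ∸ a) (when (p ℕ.* a ℕ.+ s′ ℕ.≡ᵇ ν) (c * Π)))
      ≡⟨ cong (λ z → when (a ≤ᵇ ρ) (when (s ℕ.≡ᵇ ρ ∸ a) z)) (when-+≡ᵇ (p ℕ.* a) s′ ν _) ⟩
    when (a ≤ᵇ ρ) (when (s ℕ.≡ᵇ ρ ∸ a) (when (p ℕ.* a ≤ᵇ ν) (when (s′ ℕ.≡ᵇ ν ∸ p ℕ.* a) (c * Π))))
      ≡⟨ cong (when (a ≤ᵇ ρ)) (when-swap (s ℕ.≡ᵇ ρ ∸ a) (p ℕ.* a ≤ᵇ ν) _) ⟩
    when (a ≤ᵇ ρ) (when (p ℕ.* a ≤ᵇ ν) (when (s ℕ.≡ᵇ ρ ∸ a) (when (s′ ℕ.≡ᵇ ν ∸ p ℕ.* a) (c * Π))))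
      ≡⟨ cong (λ z → when (a ≤ᵇ ρ) (when (p ℕ.* a ≤ᵇ ν) z)) (when²-*ˡ (s ℕ.≡ᵇ ρ ∸ a) (s′ ℕ.≡ᵇ ν ∸ p ℕ.* a) c Π) ⟩
    when (a ≤ᵇ ρ) (when (p ℕ.* a ≤ᵇ ν) (c * summand (suc p) (ν ∸ p ℕ.* a) (ρ ∸ a) v)) ∎
    where
    open ≡-Reasoning
    s s′ : ℕ
    s  = nsum (Vec.toList v)
    s′ = nsum (map w (indexFrom (suc p) (Vec.toList v)))
    c Π : ℚ
    c  = expTerm x p a
    Π  = qprod (map termOf (indexFrom (suc p) (Vec.toList v)))

  summand-[] : ∀ p ν ρ → qsum (map (summand p ν ρ) (allVecs B 0)) ≡ multSum p 0 ν ρ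
  summand-[] p zero    zero    = refl
  summand-[] p zero    (suc ρ) = refl
  summand-[] p (suc ν) zero    = refl
  summand-[] p (suc ν) (suc ρ) = refl

  multSum-enum : ∀ L p ν ρ → qsum (map (summand p ν ρ) (allVecs B L)) ≡ multSum p L ν ρ
  multSum-enum zero    p ν ρ = summand-[] p ν ρ
  multSum-enum (suc L) p ν ρ = trans (qsum-allVecs-suc B L (summand p ν ρ)) (sumBelow-cong (suc B) (λ a _ → firstEntry a))
    where
    firstEntry : ∀ a → qsum (map (λ v → summand p ν ρ (a Vec.∷ v)) (allVecs B L)) ≡ slice p L ν ρ a
    firstEntry a = begin
      qsum (map (λ v → summand p ν ρ (a Vec.∷ v)) (allVecs B L))
        ≡⟨ qsum-cong (allVecs B L) (summand-cons p ν ρ a) ⟩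
      qsum (map (λ v → when (a ≤ᵇ ρ) (when (pa ≤ᵇ ν) (c * rest v))) (allVecs B L))
        ≡⟨ trans (qsum-when (allVecs B L) (a ≤ᵇ ρ) _) (cong (when (a ≤ᵇ ρ)) (qsum-when (allVecs B L) (pa ≤ᵇ ν) _)) ⟩
      when (a ≤ᵇ ρ) (when (pa ≤ᵇ ν) (qsum (map (λ v → c * rest v) (allVecs B L))))
        ≡⟨ cong (λ z → when (a ≤ᵇ ρ) (when (pa ≤ᵇ ν) z)) (qsum-*ˡ (allVecs B L) c rest) ⟩
      when (a ≤ᵇ ρ) (when (pa ≤ᵇ ν) (c * qsum (map rest (allVecs B L))))
        ≡⟨ cong (λ z → when (a ≤ᵇ ρ) (when (pa ≤ᵇ ν) (c * z))) (multSum-enum L (suc p) (ν ∸ pa) (ρ ∸ a)) ⟩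
      slice p L ν ρ a ∎
      where
      open ≡-Reasoning
      pa : ℕ
      pa = p ℕ.* a
      c : ℚ
      c  = expTerm x p a
      rest : Vec ℕ L → ℚ
      rest = summand (suc p) (ν ∸ pa) (ρ ∸ a)

bell-multSum : ∀ x n r (w : ℕ × ℕ → ℕ) (w-eq : ∀ i a → w (i , a) ≡ i ℕ.* a)
  (g : ℕ × ℕ → ℚ) → (∀ i a → g (i , a) ≡ expTerm x i a) →
  qsum (map (λ rs → ℕ→ℚ (n !) * qprod (map g (indexed rs)))
    (filterᵇ (λ rs → (nsum (Vec.toList rs) ℕ.≡ᵇ r) ∧ (nsum (map w (indexed rs)) ℕ.≡ᵇ n)) (allVecs n n)))
  ≡ ℕ→ℚ (n !) * Multiplicities.multSum x n 1 n n r
bell-multSum x n r w w-eq g g-eq = begin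
  qsum (map (λ rs → n! * qprod (map g (indexed rs))) (filterᵇ constraints (allVecs n n)))
    ≡⟨ qsum-filter (allVecs n n) constraints _ ⟩
  qsum (map (λ rs → when (constraints rs) (n! * qprod (map g (indexed rs)))) (allVecs n n))
    ≡⟨ qsum-cong (allVecs n n) asSummand ⟩
  qsum (map (λ v → n! * summand 1 n r v) (allVecs n n))
    ≡⟨ qsum-*ˡ (allVecs n n) n! (summand 1 n r) ⟩
  n! * qsum (map (summand 1 n r) (allVecs n n))
    ≡⟨ cong (n! *_) (multSum-enum n 1 n r) ⟩
  n! * Multiplicities.multSum x n 1 n n r ∎
  where
  open ≡-Reasoning
  open Enumerated x n w w-eq
  n! : ℚ
  n! = ℕ→ℚ (n !)
  constraints : Vec ℕ n → Bool
  constraints rs = (nsum (Vec.toList rs) ℕ.≡ᵇ r) ∧ (nsum (map w (indexed rs)) ℕ.≡ᵇ n)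
  asSummand : ∀ v → when (constraints v) (n! * qprod (map g (indexed v))) ≡ n! * summand 1 n r v
  asSummand v rewrite zip-tabulate≡indexFrom v (λ i → suc (toℕ i)) 1 (λ i → refl) =
    trans (when-∧ (nsum (Vec.toList v) ℕ.≡ᵇ r) _ _)
      (trans (cong (λ z → when (nsum (Vec.toList v) ℕ.≡ᵇ r) (when (nsum (map w (indexFrom 1 (Vec.toList v))) ℕ.≡ᵇ n) (n! * z)))
                   (qprod-cong (indexFrom 1 (Vec.toList v)) (λ { (i , a) → g-eq i a })))
             (when²-*ˡ (nsum (Vec.toList v) ℕ.≡ᵇ r) (nsum (map w (indexFrom 1 (Vec.toList v))) ℕ.≡ᵇ n) n! _))

bellTerm-expTerm : ∀ (x : ℕ → ℚ) i a → ((ℕ→ℚ (i !) * x i) * inv! i) ^ℚ a * inv! a ≡ expTerm x i a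
bellTerm-expTerm x i a = cong (λ z → z ^ℚ a * inv! a)
  (trans (solve 3 (λ F X I → (F :* X) :* I := X :* (I :* F)) refl (ℕ→ℚ (i !)) (x i) (inv! i))
         (trans (cong (x i *_) (inv!-inverse i)) (ℚP.*-identityʳ (x i))))

bell-compPoly : ∀ (x : ℕ → ℚ) n r → ℕ→ℚ (r !) * bell n r (λ i → ℕ→ℚ (i !) * x i) ≡ ℕ→ℚ (n !) * compPoly x n r
bell-compPoly x n r = begin
  ℕ→ℚ (r !) * bell n r (λ i → ℕ→ℚ (i !) * x i)
    ≡⟨ cong (ℕ→ℚ (r !) *_) (bell-multSum x n r _ (λ _ _ → refl) _ (bellTerm-expTerm x)) ⟩
  ℕ→ℚ (r !) * (ℕ→ℚ (n !) * multSum 1 n n r)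
    ≡⟨ solve 3 (λ a b c → a :* (b :* c) := b :* (a :* c)) refl (ℕ→ℚ (r !)) (ℕ→ℚ (n !)) _ ⟩
  ℕ→ℚ (n !) * (ℕ→ℚ (r !) * multSum 1 n n r)
    ≡⟨ cong (ℕ→ℚ (n !) *_) (multSum-compPoly r n ℕP.≤-refl) ⟩
  ℕ→ℚ (n !) * compPoly x n r ∎
  where
  open ≡-Reasoning
  open Multiplicities x n

-- Binomial coefficients by Pascal's rule, so that they compute on successors.
binom : ℕ → ℕ → ℕ
binom n       zero    = 1
binom zero    (suc k) = 0
binom (suc n) (suc k) = binom n k ℕ.+ binom n (suc k)

binom≡C : ∀ n k → binom n k ≡ n C k
binom≡C n       zero    = refl
binom≡C zero    (suc k) = refl
binom≡C (suc n) (suc k) = trans (cong₂ ℕ._+_ (binom≡C n k) (binom≡C n (suc k))) (nCk+nC[k+1]≡[n+1]C[k+1] n k)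

-- openRun σ c κ l = Σ_{r ≤ κ} σ_{c+r}·compPoly σ (κ-r) l: a zero run of
-- length c, still open, absorbs r of the κ remaining zeros, and the other
-- κ-r zeros form l further runs.
openRun : (ℕ → ℚ) → ℕ → ℕ → ℕ → ℚ
openRun σ c zero    l = σ c * compPoly σ 0 l
openRun σ c (suc κ) l = σ c * compPoly σ (suc κ) l + openRun σ (suc c) κ l

openRun-sumBelow : ∀ σ κ c l → openRun σ c κ l ≡ sumBelow (suc κ) (λ r → σ (c ℕ.+ r) * compPoly σ (κ ∸ r) l)
openRun-sumBelow σ zero    c l = trans (cong (λ z → σ z * compPoly σ 0 l) (sym (ℕP.+-identityʳ c))) (sym (ℚP.+-identityʳ _))
openRun-sumBelow σ (suc κ) c l = cong₂ _+_ (cong (λ z → σ z * compPoly σ (suc κ) l) (sym (ℕP.+-identityʳ c)))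
  (trans (openRun-sumBelow σ κ (suc c) l)
         (sumBelow-cong (suc κ) (λ r _ → cong (λ z → σ z * compPoly σ (κ ∸ r) l) (sym (ℕP.+-suc c r)))))

-- A run opened from scratch is the first part of a composition of the zeros.
openRun-1 : ∀ σ κ l → openRun σ 1 κ l ≡ compPoly σ (suc κ) (suc l)
openRun-1 σ κ l = openRun-sumBelow σ κ 1 l

atPositive : (ℕ → ℚ) → ℕ → ℚ
atPositive f zero    = 1ℚ
atPositive f (suc a) = f (suc a)

count0≤length : ∀ {J} (w : Vec ℕ J) → count 0 (Vec.toList w) ≤ J
count0≤length Vec.[]          = z≤n
count0≤length (zero  Vec.∷ w) = s≤s (count0≤length w)
count0≤length (suc a Vec.∷ w) = ℕP.m≤n⇒m≤1+n (count0≤length w)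

module Scan (τ σ : ℕ → ℚ) (M : ℕ) where

  -- Weight of the parts L under the constraints (sum μ, κ zeros, l runs),
  -- when L is preceded by an open zero run of length c₀.
  scanned : (μ κ l c₀ : ℕ) → List ℕ → ℚ
  scanned μ κ l c₀ L = when (nsum L ℕ.≡ᵇ μ) (when (count 0 L ℕ.≡ᵇ κ) (when (length (runs c₀ L) ℕ.≡ᵇ l)
                         (qprod (map (atPositive τ) L) * qprod (map (atPositive σ) (runs c₀ L)))))

  scanSum : (J μ κ l c₀ : ℕ) → ℚ
  scanSum J μ κ l c₀ = qsum (map (λ w → scanned μ κ l c₀ (Vec.toList w)) (allVecs M J))

  -- A positive part closes the open run of length c₀, if there is one; that
  -- run is one of the l runs and contributes the factor σ_{c₀}.
  closing : (c₀ l : ℕ) → (ℕ → ℚ) → ℚ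
  closing zero    l       F = F l
  closing (suc c) zero    F = 0ℚ
  closing (suc c) (suc l) F = σ (suc c) * F l

  closing-cong : ∀ c₀ l {F G : ℕ → ℚ} → (∀ l′ → F l′ ≡ G l′) → closing c₀ l F ≡ closing c₀ l G
  closing-cong zero    l       h = h l
  closing-cong (suc c) zero    h = refl
  closing-cong (suc c) (suc l) h = cong (σ (suc c) *_) (h l)

  closing-*ʳ : ∀ c₀ l (F : ℕ → ℚ) y → closing c₀ l (λ l′ → F l′ * y) ≡ closing c₀ l F * y
  closing-*ʳ zero    l       F y = refl
  closing-*ʳ (suc c) zero    F y = sym (ℚP.*-zeroˡ y)
  closing-*ʳ (suc c) (suc l) F y = sym (ℚP.*-assoc (σ (suc c)) (F l) y)

  closing-0 : ∀ c₀ l {F : ℕ → ℚ} → (∀ l′ → F l′ ≡ 0ℚ) → closing c₀ l F ≡ 0ℚ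
  closing-0 c₀ l h = trans (closing-cong c₀ l (λ l′ → trans (h l′) (sym (ℚP.*-zeroˡ 0ℚ))))
                           (trans (closing-*ʳ c₀ l (λ _ → 0ℚ) 0ℚ) (ℚP.*-zeroʳ (closing c₀ l (λ _ → 0ℚ))))

  qsum-closing : ∀ {A : Set} c₀ l (L : List A) (F : ℕ → A → ℚ) →
    qsum (map (λ v → closing c₀ l (λ l′ → F l′ v)) L) ≡ closing c₀ l (λ l′ → qsum (map (F l′) L))
  qsum-closing zero    l       L F = refl
  qsum-closing (suc c) zero    L F = qsum-0 L (λ _ → refl)
  qsum-closing (suc c) (suc l) L F = qsum-*ˡ L (σ (suc c)) (F l)

  scanned-zero-none : ∀ μ l c₀ L → scanned μ 0 l c₀ (0 ∷ L) ≡ 0ℚ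
  scanned-zero-none μ l c₀ L = when-0 (nsum L ℕ.≡ᵇ μ)

  scanned-zero : ∀ μ κ l c₀ L → scanned μ (suc κ) l c₀ (0 ∷ L) ≡ scanned μ κ l (suc c₀) L
  scanned-zero μ κ l c₀ L = cong (λ z → when (nsum L ℕ.≡ᵇ μ) (when (count 0 L ℕ.≡ᵇ κ)
                                   (when (length (runs (suc c₀) L) ℕ.≡ᵇ l) (z * qprod (map (atPositive σ) (runs (suc c₀) L))))))
                              (ℚP.*-identityˡ (qprod (map (atPositive τ) L)))

  scanned-part : ∀ μ κ l c₀ a L →
    scanned μ κ l c₀ (suc a ∷ L) ≡ when (suc a ≤ᵇ μ) (τ (suc a) * closing c₀ l (λ l′ → scanned (μ ∸ suc a) κ l′ 0 L))
  scanned-part μ κ l zero a L = trans (when-+≡ᵇ (suc a) (nsum L) μ _) (cong (when (suc a ≤ᵇ μ))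
    (trans (cong (λ z → when b₁ (when b₂ (when b₃ z))) (ℚP.*-assoc (τ (suc a)) A Π))
           (when³-*ˡ b₁ b₂ b₃ (τ (suc a)) (A * Π))))
    where
    b₁ b₂ b₃ : Bool
    b₁ = nsum L ℕ.≡ᵇ μ ∸ suc a
    b₂ = count 0 L ℕ.≡ᵇ κ
    b₃ = length (runs 0 L) ℕ.≡ᵇ l
    A Π : ℚ
    A  = qprod (map (atPositive τ) L)
    Π  = qprod (map (atPositive σ) (runs 0 L))
  scanned-part μ κ zero (suc c) a L =
    trans (cong (when (suc a ℕ.+ nsum L ℕ.≡ᵇ μ)) (when-0 (count 0 L ℕ.≡ᵇ κ)))
          (trans (when-0 (suc a ℕ.+ nsum L ℕ.≡ᵇ μ))
                 (sym (trans (cong (when (suc a ≤ᵇ μ)) (ℚP.*-zeroʳ (τ (suc a)))) (when-0 (suc a ≤ᵇ μ)))))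
  scanned-part μ κ (suc l) (suc c) a L = trans (when-+≡ᵇ (suc a) (nsum L) μ _) (cong (when (suc a ≤ᵇ μ))
    (trans (cong (λ z → when b₁ (when b₂ (when b₃ z)))
                 (solve 4 (λ t A s B → (t :* A) :* (s :* B) := t :* (s :* (A :* B))) refl (τ (suc a)) A (σ (suc c)) Π))
      (trans (when³-*ˡ b₁ b₂ b₃ (τ (suc a)) (σ (suc c) * (A * Π)))
             (cong (τ (suc a) *_) (when³-*ˡ b₁ b₂ b₃ (σ (suc c)) (A * Π))))))
    where
    b₁ b₂ b₃ : Bool
    b₁ = nsum L ℕ.≡ᵇ μ ∸ suc a
    b₂ = count 0 L ℕ.≡ᵇ κ
    b₃ = length (runs 0 L) ℕ.≡ᵇ l
    A Π : ℚ
    A  = qprod (map (atPositive τ) L)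
    Π  = qprod (map (atPositive σ) (runs 0 L))

  leadZero : (J μ κ l c₀ : ℕ) → ℚ
  leadZero J μ κ l c₀ = qsum (map (λ w → scanned μ κ l c₀ (0 ∷ Vec.toList w)) (allVecs M J))

  leadPart : (J μ κ l c₀ : ℕ) → ℚ
  leadPart J μ κ l c₀ = sumBelow M (λ a → qsum (map (λ w → scanned μ κ l c₀ (suc a ∷ Vec.toList w)) (allVecs M J)))

  scanSum-split : ∀ J μ κ l c₀ → scanSum (suc J) μ κ l c₀ ≡ leadZero J μ κ l c₀ + leadPart J μ κ l c₀
  scanSum-split J μ κ l c₀ = qsum-allVecs-suc M J (λ w → scanned μ κ l c₀ (Vec.toList w))

  leadPart-eq : ∀ J μ κ l c₀ →
    leadPart J μ κ l c₀ ≡ sumBelow M (λ a → when (suc a ≤ᵇ μ) (τ (suc a) * closing c₀ l (λ l′ → scanSum J (μ ∸ suc a) κ l′ 0)))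
  leadPart-eq J μ κ l c₀ = sumBelow-cong M (λ a _ →
    trans (qsum-cong (allVecs M J) (λ w → scanned-part μ κ l c₀ a (Vec.toList w)))
      (trans (qsum-when (allVecs M J) (suc a ≤ᵇ μ) _)
        (cong (when (suc a ≤ᵇ μ))
          (trans (qsum-*ˡ (allVecs M J) (τ (suc a)) _)
                 (cong (τ (suc a) *_) (qsum-closing c₀ l (allVecs M J) (λ l′ w → scanned (μ ∸ suc a) κ l′ 0 (Vec.toList w))))))))

  convolve : ∀ μ n (G : ℕ → ℚ) K → μ ≤ M → (∀ a → G a ≡ K * compPoly τ (μ ∸ suc a) n) →
    sumBelow M (λ a → when (suc a ≤ᵇ μ) (τ (suc a) * G a)) ≡ K * compPoly τ μ (suc n)
  convolve μ n G K μ≤M hG = trans (sumBelow-guarded μ M _ μ≤M)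
    (trans (sumBelow-cong μ (λ a _ → trans (cong (τ (suc a) *_) (hG a))
              (solve 3 (λ t k p → t :* (k :* p) := k :* (t :* p)) refl (τ (suc a)) K (compPoly τ (μ ∸ suc a) n))))
      (sumBelow-*ˡ μ K (λ a → τ (suc a) * compPoly τ (μ ∸ suc a) n)))

  scanSum-tooManyZeros : ∀ J μ κ l c₀ → J < κ → scanSum J μ κ l c₀ ≡ 0ℚ
  scanSum-tooManyZeros J μ κ l c₀ J<κ = qsum-0 (allVecs M J) vanish
    where
    vanish : ∀ w → scanned μ κ l c₀ (Vec.toList w) ≡ 0ℚ
    vanish w rewrite ≡ᵇ-false (count 0 (Vec.toList w)) κ (ℕP.≤-<-trans (count0≤length w) J<κ) = when-0 (nsum (Vec.toList w) ℕ.≡ᵇ μ)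

  -- Closed form of scanSum J μ κ l c₀ with n = J - κ positive parts.  With
  -- no open run, the l runs occupy l of the n+1 gaps around the positive
  -- parts; with an open run, it is the first run and the other l-1 runs
  -- occupy l-1 of the n gaps following the positive parts.
  closedForm : (n μ κ l c₀ : ℕ) → ℚ
  closedForm n μ κ l       zero    = ℕ→ℚ (binom (suc n) l) * compPoly τ μ n * compPoly σ κ l
  closedForm n μ κ zero    (suc c) = 0ℚ
  closedForm n μ κ (suc l) (suc c) = ℕ→ℚ (binom n l) * compPoly τ μ n * openRun σ (suc c) κ l

  zeroStep : (n μ κ l c₀ : ℕ) → ℚ
  zeroStep n μ zero    l c₀ = 0ℚ
  zeroStep n μ (suc κ) l c₀ = closedForm n μ κ l (suc c₀)

  partStep : (n μ κ l c₀ : ℕ) → ℚ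
  partStep n μ κ l c₀ = closing c₀ l (λ l′ → ℕ→ℚ (binom n l′) * compPoly σ κ l′) * compPoly τ μ n

  -- The closed form obeys the first-part recurrence: Pascal's rule when no
  -- run is open, the unfolding of openRun otherwise.
  closedForm-step : ∀ n μ κ l c₀ → zeroStep n μ κ l c₀ + partStep n μ κ l c₀ ≡ closedForm n μ κ l c₀
  closedForm-step n μ zero zero zero =
    solve 3 (λ b s p → con 0ℚ :+ b :* s :* p := b :* p :* s) refl (ℕ→ℚ 1) (compPoly σ 0 0) (compPoly τ μ n)
  closedForm-step n μ (suc κ) zero zero =
    solve 3 (λ b s p → con 0ℚ :+ b :* s :* p := b :* p :* s) refl (ℕ→ℚ 1) (compPoly σ (suc κ) 0) (compPoly τ μ n)
  closedForm-step n μ zero (suc l) zero =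
    solve 3 (λ b c p → con 0ℚ :+ b :* con 0ℚ :* p := c :* p :* con 0ℚ) refl (ℕ→ℚ (binom n (suc l))) (ℕ→ℚ (binom (suc n) (suc l))) (compPoly τ μ n)
  closedForm-step n μ (suc κ) (suc l) zero = begin
    b₀ * Pτ * openRun σ 1 κ l + b₁ * Pσ * Pτ
      ≡⟨ cong (λ z → b₀ * Pτ * z + b₁ * Pσ * Pτ) (openRun-1 σ κ l) ⟩
    b₀ * Pτ * Pσ + b₁ * Pσ * Pτ
      ≡⟨ solve 4 (λ a b p q → a :* p :* q :+ b :* q :* p := (a :+ b) :* p :* q) refl b₀ b₁ Pτ Pσ ⟩
    (b₀ + b₁) * Pτ * Pσ
      ≡⟨ cong (λ z → z * Pτ * Pσ) (sym (ℕ→ℚ-+ (binom n l) (binom n (suc l)))) ⟩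
    ℕ→ℚ (binom (suc n) (suc l)) * Pτ * Pσ ∎
    where
    open ≡-Reasoning
    b₀ b₁ Pτ Pσ : ℚ
    b₀ = ℕ→ℚ (binom n l); b₁ = ℕ→ℚ (binom n (suc l))
    Pτ = compPoly τ μ n;  Pσ = compPoly σ (suc κ) (suc l)
  closedForm-step n μ zero    zero (suc c) = trans (ℚP.+-identityˡ _) (ℚP.*-zeroˡ (compPoly τ μ n))
  closedForm-step n μ (suc κ) zero (suc c) = trans (ℚP.+-identityˡ _) (ℚP.*-zeroˡ (compPoly τ μ n))
  closedForm-step n μ zero (suc l) (suc c) =
    solve 4 (λ s b q p → con 0ℚ :+ s :* (b :* q) :* p := b :* p :* (s :* q)) refl
      (σ (suc c)) (ℕ→ℚ (binom n l)) (compPoly σ 0 l) (compPoly τ μ n)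
  closedForm-step n μ (suc κ) (suc l) (suc c) =
    solve 5 (λ b p r s q → b :* p :* r :+ s :* (b :* q) :* p := b :* p :* (s :* q :+ r)) refl
      (ℕ→ℚ (binom n l)) (compPoly τ μ n) (openRun σ (suc (suc c)) κ l) (σ (suc c)) (compPoly σ (suc κ) l)

  scanSum-empty : ∀ μ l c₀ → scanSum 0 μ 0 l c₀ ≡ closedForm 0 μ 0 l c₀
  scanSum-empty zero    zero          zero    = refl
  scanSum-empty zero    (suc l)       zero    = sym (ℚP.*-zeroʳ (ℕ→ℚ (binom 1 (suc l)) * compPoly τ 0 0))
  scanSum-empty (suc μ) l             zero    = sym (trans (cong (_* compPoly σ 0 l) (ℚP.*-zeroʳ (ℕ→ℚ (binom 1 l))))
                                                           (ℚP.*-zeroˡ (compPoly σ 0 l)))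
  scanSum-empty μ       zero          (suc c) = trans (ℚP.+-identityʳ _) (when-0 (0 ℕ.≡ᵇ μ))
  scanSum-empty zero    (suc zero)    (suc c) =
    trans (ℚP.+-identityʳ _) (solve 1 (λ s → con 1ℚ :* (s :* con 1ℚ) := con 1ℚ :* con 1ℚ :* (s :* con 1ℚ)) refl (σ (suc c)))
  scanSum-empty (suc μ) (suc zero)    (suc c) = sym (trans (cong (_* openRun σ (suc c) 0 0) (ℚP.*-zeroʳ (ℕ→ℚ 1)))
                                                           (ℚP.*-zeroˡ (openRun σ (suc c) 0 0)))
  scanSum-empty μ       (suc (suc l)) (suc c) = trans (trans (ℚP.+-identityʳ _) (when-0 (0 ℕ.≡ᵇ μ)))
    (sym (trans (cong (_* openRun σ (suc c) 0 (suc l)) (ℚP.*-zeroˡ (compPoly τ μ 0))) (ℚP.*-zeroˡ (openRun σ (suc c) 0 (suc l)))))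

  ClosedAt : ℕ → Set
  ClosedAt J = ∀ n κ → n ℕ.+ κ ≡ J → ∀ μ l c₀ → μ ≤ M → scanSum J μ κ l c₀ ≡ closedForm n μ κ l c₀

  leadZero-closed : ∀ J → ClosedAt J → ∀ n κ → n ℕ.+ κ ≡ suc J → ∀ μ l c₀ → μ ≤ M →
    leadZero J μ κ l c₀ ≡ zeroStep n μ κ l c₀
  leadZero-closed J closedAt n zero    e μ l c₀ μ≤M = qsum-0 (allVecs M J) (λ w → scanned-zero-none μ l c₀ (Vec.toList w))
  leadZero-closed J closedAt n (suc κ) e μ l c₀ μ≤M =
    trans (qsum-cong (allVecs M J) (λ w → scanned-zero μ κ l c₀ (Vec.toList w)))
          (closedAt n κ (ℕP.suc-injective (trans (sym (ℕP.+-suc n κ)) e)) μ l (suc c₀) μ≤M)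

  leadPart-closed : ∀ J → ClosedAt J → ∀ n κ → n ℕ.+ κ ≡ suc J → ∀ μ l c₀ → μ ≤ M →
    leadPart J μ κ l c₀ ≡ partStep n μ κ l c₀
  -- with no positive part left, the remaining J parts cannot hold all J+1 zeros
  leadPart-closed J closedAt zero .(suc J) refl μ l c₀ μ≤M =
    trans (leadPart-eq J μ (suc J) l c₀) (trans (sumBelow-0 M (λ a _ → noRoom a)) (sym noClosedForm))
    where
    noRoom : ∀ a → when (suc a ≤ᵇ μ) (τ (suc a) * closing c₀ l (λ l′ → scanSum J (μ ∸ suc a) (suc J) l′ 0)) ≡ 0ℚ
    noRoom a = trans (cong (λ z → when (suc a ≤ᵇ μ) (τ (suc a) * z))
                           (closing-0 c₀ l (λ l′ → scanSum-tooManyZeros J (μ ∸ suc a) (suc J) l′ 0 (ℕP.n<1+n J))))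
                     (trans (cong (when (suc a ≤ᵇ μ)) (ℚP.*-zeroʳ (τ (suc a)))) (when-0 (suc a ≤ᵇ μ)))
    vanish : ∀ l′ → ℕ→ℚ (binom 0 l′) * compPoly σ (suc J) l′ ≡ 0ℚ
    vanish zero     = ℚP.*-zeroʳ 1ℚ
    vanish (suc l′) = ℚP.*-zeroˡ (compPoly σ (suc J) (suc l′))
    noClosedForm : partStep 0 μ (suc J) l c₀ ≡ 0ℚ
    noClosedForm = trans (cong (_* compPoly τ μ 0) (closing-0 c₀ l vanish)) (ℚP.*-zeroˡ (compPoly τ μ 0))
  leadPart-closed J closedAt (suc n) κ e μ l c₀ μ≤M = begin
    leadPart J μ κ l c₀
      ≡⟨ leadPart-eq J μ κ l c₀ ⟩
    sumBelow M (λ a → when (suc a ≤ᵇ μ) (τ (suc a) * rest a))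
      ≡⟨ convolve μ n rest K μ≤M restClosed ⟩
    K * compPoly τ μ (suc n) ∎
    where
    open ≡-Reasoning
    rest : ℕ → ℚ
    rest a = closing c₀ l (λ l′ → scanSum J (μ ∸ suc a) κ l′ 0)
    coefficient : ℕ → ℚ
    coefficient l′ = ℕ→ℚ (binom (suc n) l′) * compPoly σ κ l′
    K : ℚ
    K = closing c₀ l coefficient
    restClosed : ∀ a → rest a ≡ K * compPoly τ (μ ∸ suc a) n
    restClosed a = trans (closing-cong c₀ l (λ l′ →
        trans (closedAt n κ (ℕP.suc-injective e) (μ ∸ suc a) l′ 0 (ℕP.≤-trans (ℕP.m∸n≤m μ (suc a)) μ≤M))
              (solve 3 (λ b p q → b :* p :* q := b :* q :* p) refl (ℕ→ℚ (binom (suc n) l′)) (compPoly τ (μ ∸ suc a) n) (compPoly σ κ l′))))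
      (closing-*ʳ c₀ l coefficient (compPoly τ (μ ∸ suc a) n))

  scanSum-closed : ∀ J → ClosedAt J
  scanSum-closed zero    zero    zero    refl μ l c₀ μ≤M = scanSum-empty μ l c₀
  scanSum-closed zero    zero    (suc κ) ()
  scanSum-closed zero    (suc n) κ       ()
  scanSum-closed (suc J) n       κ       e    μ l c₀ μ≤M = begin
    scanSum (suc J) μ κ l c₀
      ≡⟨ scanSum-split J μ κ l c₀ ⟩
    leadZero J μ κ l c₀ + leadPart J μ κ l c₀
      ≡⟨ cong₂ _+_ (leadZero-closed J (scanSum-closed J) n κ e μ l c₀ μ≤M)
                   (leadPart-closed J (scanSum-closed J) n κ e μ l c₀ μ≤M) ⟩
    zeroStep n μ κ l c₀ + partStep n μ κ l c₀
      ≡⟨ closedForm-step n μ κ l c₀ ⟩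
    closedForm n μ κ l c₀ ∎
    where open ≡-Reasoning

prodBelow : ℕ → (ℕ → ℚ) → ℚ
prodBelow zero    f = 1ℚ
prodBelow (suc n) f = f 0 * prodBelow n (λ a → f (suc a))

prodBelow-cong : ∀ n {f g : ℕ → ℚ} → (∀ a → f a ≡ g a) → prodBelow n f ≡ prodBelow n g
prodBelow-cong zero    h = refl
prodBelow-cong (suc n) h = cong₂ _*_ (h 0) (prodBelow-cong n (λ a → h (suc a)))

prodBelow-1 : ∀ n {f : ℕ → ℚ} → (∀ a → f a ≡ 1ℚ) → prodBelow n f ≡ 1ℚ
prodBelow-1 zero    h = refl
prodBelow-1 (suc n) h = trans (cong₂ _*_ (h 0) (prodBelow-1 n (λ a → h (suc a)))) (ℚP.*-identityˡ 1ℚ)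

prodBelow-* : ∀ n (f g : ℕ → ℚ) → prodBelow n (λ a → f a * g a) ≡ prodBelow n f * prodBelow n g
prodBelow-* zero    f g = sym (ℚP.*-identityˡ 1ℚ)
prodBelow-* (suc n) f g = trans (cong (f 0 * g 0 *_) (prodBelow-* n _ _))
  (solve 4 (λ a b c d → a :* b :* (c :* d) := a :* c :* (b :* d)) refl (f 0) (g 0) (prodBelow n (λ a → f (suc a))) (prodBelow n (λ a → g (suc a))))

qprod-applyUpTo : ∀ n (h : ℕ → ℕ) (F : ℕ → ℚ) → qprod (map F (map suc (applyUpTo h n))) ≡ prodBelow n (λ a → F (suc (h a)))
qprod-applyUpTo zero    h F = refl
qprod-applyUpTo (suc n) h F = cong (F (suc (h 0)) *_) (qprod-applyUpTo n (λ a → h (suc a)) F)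

restrictTo : ℕ → (ℕ → ℚ) → ℕ → ℚ
restrictTo B f i = if i ≤ᵇ B then f i else 1ℚ

prodBelow-select : ∀ B (f : ℕ → ℚ) x →
  prodBelow B (λ a → if suc a ℕ.≡ᵇ x then f (suc a) else 1ℚ) ≡ atPositive (restrictTo B f) x
prodBelow-select zero    f zero          = refl
prodBelow-select zero    f (suc x)       = refl
prodBelow-select (suc B) f zero          = trans (ℚP.*-identityˡ _) (prodBelow-1 B (λ a → refl))
prodBelow-select (suc B) f (suc zero)    = trans (cong (f 1 *_) (prodBelow-1 B (λ a → refl))) (ℚP.*-identityʳ (f 1))
prodBelow-select (suc B) f (suc (suc x)) = trans (ℚP.*-identityˡ _) (prodBelow-select B (λ i → f (suc i)) (suc x))

^ℚ-if : ∀ b (y : ℚ) c → y ^ℚ (if b then suc c else c) ≡ (if b then y else 1ℚ) * y ^ℚ c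
^ℚ-if true  y c = refl
^ℚ-if false y c = sym (ℚP.*-identityˡ _)

prodBelow-powers : ∀ B (f : ℕ → ℚ) L →
  prodBelow B (λ a → f (suc a) ^ℚ count (suc a) L) ≡ qprod (map (atPositive (restrictTo B f)) L)
prodBelow-powers B f []      = prodBelow-1 B (λ a → refl)
prodBelow-powers B f (x ∷ L) = begin
  prodBelow B (λ a → f (suc a) ^ℚ count (suc a) (x ∷ L))
    ≡⟨ prodBelow-cong B (λ a → ^ℚ-if (suc a ℕ.≡ᵇ x) (f (suc a)) (count (suc a) L)) ⟩
  prodBelow B (λ a → (if suc a ℕ.≡ᵇ x then f (suc a) else 1ℚ) * f (suc a) ^ℚ count (suc a) L)
    ≡⟨ prodBelow-* B _ _ ⟩
  prodBelow B (λ a → if suc a ℕ.≡ᵇ x then f (suc a) else 1ℚ) * prodBelow B (λ a → f (suc a) ^ℚ count (suc a) L)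
    ≡⟨ cong₂ _*_ (prodBelow-select B f x) (prodBelow-powers B f L) ⟩
  atPositive (restrictTo B f) x * qprod (map (atPositive (restrictTo B f)) L) ∎
  where open ≡-Reasoning

qprod-powers : ∀ B (f : ℕ → ℚ) L → qprod (map (λ i → f i ^ℚ count i L) (oneTo B)) ≡ qprod (map (atPositive (restrictTo B f)) L)
qprod-powers B f L = trans (qprod-applyUpTo B (λ a → a) (λ i → f i ^ℚ count i L)) (prodBelow-powers B f L)

compPoly-agree : ∀ n μ (f g : ℕ → ℚ) → (∀ i → i ≤ μ → f i ≡ g i) → compPoly f μ n ≡ compPoly g μ n
compPoly-agree zero    μ f g h = refl
compPoly-agree (suc n) μ f g h = sumBelow-cong μ (λ a a<μ → cong₂ _*_ (h (suc a) a<μ)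
  (compPoly-agree n (μ ∸ suc a) f g (λ i i≤ → h i (ℕP.≤-trans i≤ (ℕP.m∸n≤m μ (suc a))))))

compPoly-restrict : ∀ B (f : ℕ → ℚ) μ n → μ ≤ B → compPoly (restrictTo B f) μ n ≡ compPoly f μ n
compPoly-restrict B f μ n μ≤B = compPoly-agree n μ (restrictTo B f) f restricted
  where
  restricted : ∀ i → i ≤ μ → restrictTo B f i ≡ f i
  restricted i i≤μ rewrite ≤⇒≤ᵇ (ℕP.≤-trans i≤μ μ≤B) = refl

-- On a vector, the constrained weight is the scanned weight (with t, s
-- cut off beyond the ranges m, j of the products in `weight`).
weight-scanned : ∀ m k j ℓ (t s : ℕ → ℚ) (c : Vec ℕ j) →
  when ((partsSum c ℕ.≡ᵇ m) ∧ (numZeros c ℕ.≡ᵇ k) ∧ (numSegments c ℕ.≡ᵇ ℓ)) (weight m j t s c)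
    ≡ Scan.scanned (restrictTo m t) (restrictTo j s) m m k ℓ 0 (Vec.toList c)
weight-scanned m k j ℓ t s c =
  trans (when-∧ (partsSum c ℕ.≡ᵇ m) _ _) (cong (when (partsSum c ℕ.≡ᵇ m)) (trans (when-∧ (numZeros c ℕ.≡ᵇ k) _ _)
    (cong (λ z → when (numZeros c ℕ.≡ᵇ k) (when (numSegments c ℕ.≡ᵇ ℓ) z))
          (cong₂ _*_ (qprod-powers m t (Vec.toList c)) (qprod-powers j s (zeroRuns (Vec.toList c)))))))

compositionSum : ∀ m k j ℓ → k ≤ j → (t s : ℕ → ℚ) →
  qsum (map (weight m j t s) (compositions m k j ℓ))
    ≡ ℕ→ℚ (binom (suc (j ∸ k)) ℓ) * compPoly t m (j ∸ k) * compPoly s k ℓ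
compositionSum m k j ℓ k≤j t s = begin
  qsum (map (weight m j t s) (compositions m k j ℓ))
    ≡⟨ qsum-filter (allVecs m j) _ (weight m j t s) ⟩
  qsum (map (λ c → when ((partsSum c ℕ.≡ᵇ m) ∧ (numZeros c ℕ.≡ᵇ k) ∧ (numSegments c ℕ.≡ᵇ ℓ)) (weight m j t s c)) (allVecs m j))
    ≡⟨ qsum-cong (allVecs m j) (weight-scanned m k j ℓ t s) ⟩
  scanSum j m k ℓ 0
    ≡⟨ scanSum-closed j (j ∸ k) k (ℕP.m∸n+n≡m k≤j) m ℓ 0 ℕP.≤-refl ⟩
  b * compPoly (restrictTo m t) m (j ∸ k) * compPoly (restrictTo j s) k ℓ
    ≡⟨ cong₂ (λ x y → b * x * y) (compPoly-restrict m t m (j ∸ k) ℕP.≤-refl) (compPoly-restrict j s k ℓ k≤j) ⟩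
  b * compPoly t m (j ∸ k) * compPoly s k ℓ ∎
  where
  open ≡-Reasoning
  open Scan (restrictTo m t) (restrictTo j s) m
  b : ℚ
  b = ℕ→ℚ (binom (suc (j ∸ k)) ℓ)

bellSide : ∀ m k n ℓ (t s : ℕ → ℚ) →
  ℕ→ℚ (((n ℕ.+ 1) C ℓ) ℕ.* n ! ℕ.* ℓ !) * inv! k * inv! m * bell m n (λ i → ℕ→ℚ (i !) * t i) * bell k ℓ (λ i → ℕ→ℚ (i !) * s i)
    ≡ ℕ→ℚ (binom (suc n) ℓ) * compPoly t m n * compPoly s k ℓ
bellSide m k n ℓ t s = begin
  ℕ→ℚ (((n ℕ.+ 1) C ℓ) ℕ.* n ! ℕ.* ℓ !) * ik * im * bt * bs
    ≡⟨ cong (λ z → z * ik * im * bt * bs) (trans (ℕ→ℚ-* (((n ℕ.+ 1) C ℓ) ℕ.* n !) (ℓ !)) (cong (_* ℓq) (ℕ→ℚ-* ((n ℕ.+ 1) C ℓ) (n !)))) ⟩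
  Cq * nq * ℓq * ik * im * bt * bs
    ≡⟨ solve 7 (λ C nq lq ik im bt bs → C :* nq :* lq :* ik :* im :* bt :* bs := C :* (nq :* bt) :* (lq :* bs) :* (ik :* im)) refl Cq nq ℓq ik im bt bs ⟩
  Cq * (nq * bt) * (ℓq * bs) * (ik * im)
    ≡⟨ cong₂ (λ x y → Cq * x * y * (ik * im)) (bell-compPoly t m n) (bell-compPoly s k ℓ) ⟩
  Cq * (mq * Pt) * (kq * Ps) * (ik * im)
    ≡⟨ solve 7 (λ C mq Pt kq Ps ik im → C :* (mq :* Pt) :* (kq :* Ps) :* (ik :* im) := C :* Pt :* Ps :* (ik :* kq) :* (im :* mq)) refl Cq mq Pt kq Ps ik im ⟩
  Cq * Pt * Ps * (ik * kq) * (im * mq)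
    ≡⟨ cong₂ (λ x y → Cq * Pt * Ps * x * y) (inv!-inverse k) (inv!-inverse m) ⟩
  Cq * Pt * Ps * 1ℚ * 1ℚ
    ≡⟨ trans (ℚP.*-identityʳ _) (ℚP.*-identityʳ _) ⟩
  Cq * Pt * Ps
    ≡⟨ cong (λ z → ℕ→ℚ z * Pt * Ps) (trans (cong (_C ℓ) (ℕP.+-comm n 1)) (sym (binom≡C (suc n) ℓ))) ⟩
  ℕ→ℚ (binom (suc n) ℓ) * Pt * Ps ∎
  where
  open ≡-Reasoning
  Cq nq ℓq mq kq ik im bt bs Pt Ps : ℚ
  Cq = ℕ→ℚ ((n ℕ.+ 1) C ℓ)
  nq = ℕ→ℚ (n !); ℓq = ℕ→ℚ (ℓ !); mq = ℕ→ℚ (m !); kq = ℕ→ℚ (k !)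
  ik = inv! k; im = inv! m
  bt = bell m n (λ i → ℕ→ℚ (i !) * t i)
  bs = bell k ℓ (λ i → ℕ→ℚ (i !) * s i)
  Pt = compPoly t m n
  Ps = compPoly s k ℓ

corollary3p3 : (m k j ℓ : ℕ) → k ≤ j → (t s : ℕ → ℚ) →
    qsum (map (weight m j t s) (compositions m k j ℓ))
      ≡ ℕ→ℚ (((Data.Nat._+_ (j ∸ k) 1) C ℓ) Data.Nat.* (j ∸ k) ! Data.Nat.* ℓ !)
        * inv! k * inv! m
        * bell m (j ∸ k) (λ i → ℕ→ℚ (i !) * t i)
        * bell k ℓ (λ i → ℕ→ℚ (i !) * s i)
corollary3p3 m k j ℓ k≤j t s = begin
  qsum (map (weight m j t s) (compositions m k j ℓ))
    ≡⟨ compositionSum m k j ℓ k≤j t s ⟩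
  ℕ→ℚ (binom (suc (j ∸ k)) ℓ) * compPoly t m (j ∸ k) * compPoly s k ℓ
    ≡⟨ bellSide m k (j ∸ k) ℓ t s ⟨
  ℕ→ℚ (((j ∸ k ℕ.+ 1) C ℓ) ℕ.* (j ∸ k) ! ℕ.* ℓ !) * inv! k * inv! m
    * bell m (j ∸ k) (λ i → ℕ→ℚ (i !) * t i) * bell k ℓ (λ i → ℕ→ℚ (i !) * s i) ∎
  where open ≡-Reasoning
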